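{- Let $K$ be a number field, $\gamma, m \in K$, and $g_{\gamma,m}(x) = (x-\gamma)^2 + m + \gamma$. Define polynomials $t_i(x) \in K[x]$ by $t_1(x) = x + \gamma$ and $t_i(x) = (t_{i-1}(x) - \gamma)^2 + x + \gamma$ for $i \geq 2$. If for some $n \geq 1$ the iterate $g_{\gamma,m}^n(x)$ is irreducible over $K$ and $g_{\gamma,m}^{n+1}(x)$ is reducible over $K$, then there exists $y \in K$ such that $y^2 = t_{n+1}(m)$.
   Context: $g_{\gamma,m}^n$ denotes the $n$-fold composition of $g_{\gamma,m}$ with itself. -}

module Defs where

open import Level using (Level; _⊔_)
open import Algebra.Bundles using (CommutativeRing)
open import Data.Nat using (ℕ; zero; suc)
open import Data.Fin using (Fin; zero; suc)
open import Data.Sum using (_⊎_)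
open import Data.List using (List; []; _∷_)
open import Data.Product using (Σ; ∃; _×_; _,_)
open import Relation.Nullary using (¬_)
open import Relation.Binary.PropositionalEquality using (_≡_)
import Data.Rational as ℚ
open ℚ using (ℚ)

-- Polynomials in one variable over a commutative ring R, represented
-- by coefficient lists (lowest degree first).  Two lists denote the
-- same polynomial iff all their coefficients agree (missing = 0).

module Poly {c ℓ : Level} (R : CommutativeRing c ℓ) where
  open CommutativeRing R using (Carrier; _≈_; _+_; _*_; -_; 0#; 1#)

  Pol : Set c
  Pol = List Carrier

  coeff : Pol → ℕ → Carrier
  coeff []       _       = 0#
  coeff (a ∷ p)  zero    = a
  coeff (a ∷ p)  (suc i) = coeff p i

  _≈ₚ_ : Pol → Pol → Set ℓ
  p ≈ₚ q = ∀ i → coeff p i ≈ coeff q i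

  IsConstant : Pol → Set ℓ
  IsConstant p = ∀ i → coeff p (suc i) ≈ 0#

  const : Carrier → Pol
  const a = a ∷ []

  X : Pol
  X = 0# ∷ 1# ∷ []

  infixl 6 _+ₚ_ _-ₚ_
  infixl 7 _*ₚ_ _·ₚ_

  _+ₚ_ : Pol → Pol → Pol
  []      +ₚ q       = q
  (a ∷ p) +ₚ []      = a ∷ p
  (a ∷ p) +ₚ (b ∷ q) = (a + b) ∷ (p +ₚ q)

  _·ₚ_ : Carrier → Pol → Pol
  a ·ₚ []      = []
  a ·ₚ (b ∷ q) = (a * b) ∷ (a ·ₚ q)

  negₚ : Pol → Pol
  negₚ p = (- 1#) ·ₚ p

  _-ₚ_ : Pol → Pol → Pol
  p -ₚ q = p +ₚ negₚ q

  _*ₚ_ : Pol → Pol → Pol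
  []      *ₚ q = []
  (a ∷ p) *ₚ q = (a ·ₚ q) +ₚ (0# ∷ (p *ₚ q))

  _∘ₚ_ : Pol → Pol → Pol
  []      ∘ₚ q = []
  (a ∷ p) ∘ₚ q = const a +ₚ (q *ₚ (p ∘ₚ q))

  eval : Pol → Carrier → Carrier
  eval []      x = 0#
  eval (a ∷ p) x = a + x * eval p x

  Reducible : Pol → Set (c ⊔ ℓ)
  Reducible p = Σ Pol λ a → Σ Pol λ b →
    (p ≈ₚ (a *ₚ b)) × ¬ IsConstant a × ¬ IsConstant b

  -- irreducible over a field: non-constant, and in every factorisation
  -- one of the factors is constant (i.e. a unit, since p ≠ 0)
  Irreducible : Pol → Set (c ⊔ ℓ)
  Irreducible p = ¬ IsConstant p ×
    (∀ a b → p ≈ₚ (a *ₚ b) → IsConstant a ⊎ IsConstant b)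

  iter : Pol → ℕ → Pol
  iter f zero    = X
  iter f (suc n) = f ∘ₚ iter f n

-- Number fields: a field K (commutative ring, 1 ≠ 0, nonzero elements
-- invertible) together with a unital ring homomorphism ℚ → K (so K has
-- characteristic 0) such that K is a finite-dimensional ℚ-vector space
-- (has a finite ℚ-basis).

module _ {c ℓ : Level} (R : CommutativeRing c ℓ) where
  open CommutativeRing R using (Carrier; _≈_; _+_; _*_; -_; 0#; 1#)

  ΣFin : (d : ℕ) → (Fin d → Carrier) → Carrier
  ΣFin zero    f = 0#
  ΣFin (suc d) f = f zero + ΣFin d (λ i → f (suc i))

record NumberField (c ℓ : Level) : Set (Level.suc (c ⊔ ℓ)) where
  field
    ring : CommutativeRing c ℓ
  open CommutativeRing ring using (Carrier; _≈_; _+_; _*_; 0#; 1#)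
  field
    1≉0     : ¬ (1# ≈ 0#)
    inverse : ∀ x → ¬ (x ≈ 0#) → ∃ λ y → x * y ≈ 1#
    ι       : ℚ → Carrier
    ι-+     : ∀ p q → ι (p ℚ.+ q) ≈ ι p + ι q
    ι-*     : ∀ p q → ι (p ℚ.* q) ≈ ι p * ι q
    ι-1     : ι ℚ.1ℚ ≈ 1#
    dim     : ℕ
    basis   : Fin dim → Carrier
    spans   : ∀ x → ∃ λ (a : Fin dim → ℚ) →
                x ≈ ΣFin ring dim (λ i → ι (a i) * basis i)
    indep   : ∀ (a : Fin dim → ℚ) →
                ΣFin ring dim (λ i → ι (a i) * basis i) ≈ 0# →
                ∀ i → a i ≡ ℚ.0ℚ

module Dyn {c ℓ : Level} (R : CommutativeRing c ℓ) where
  open CommutativeRing R using (Carrier; _+_)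
  open Poly R

  g : Carrier → Carrier → Pol
  g γ m = ((X -ₚ const γ) *ₚ (X -ₚ const γ)) +ₚ const (m + γ)

  -- t_1(x) = x + γ,  t_i(x) = (t_{i-1}(x) - γ)^2 + x + γ  (i ≥ 2).
  -- (The paper indexes from 1; the value at index 0 is an unused
  --  dummy, set equal to t_1.)
  t : Carrier → ℕ → Pol
  t γ zero          = X +ₚ const γ
  t γ (suc zero)    = X +ₚ const γ
  t γ (suc (suc i)) =
    ((t γ (suc i) -ₚ const γ) *ₚ (t γ (suc i) -ₚ const γ)) +ₚ X +ₚ const γ

module Submission where

open import Defs
open import Data.Nat using (ℕ; zero; suc; _≤_)
open import Data.Product using (∃; _,_; map₂)
open import Algebra.Bundles using (CommutativeRing)
import Level
open import Relation.Nullary using (¬_; Dec)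

-- Put o = m + γ and φ(x) = gⁿ(x + o).  As g(x + γ) = x² + o, we
-- have gⁿ⁺¹(x + γ) = φ(x²), so a factorisation gⁿ⁺¹ = A·B yields
-- φ(x²) = Â·B̂ with Â, B̂ nonconstant.  φ is monic of degree 2ⁿ, which is
-- even as n ≥ 1, and indecomposable because gⁿ is irreducible.  The norms
-- N(Â)(x²) = Â(x)·Â(-x) and N(B̂) satisfy N(Â)·N(B̂) = φ², so by Euclid's
-- lemma N(Â) = l·φ.  Top coefficients give l = lc(Â)², constant terms give
-- Â(0)² = l·φ(0); hence φ(0) = gⁿ(o) = tₙ₊₁(m) is a square.

-- The stdlib solver 'Algebra.Solver.Ring' normalises with coefficients
-- in a raw ring that maps into the target ring and needs a (weak) test
-- for equality of coefficients in order to cancel terms such as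
-- x + (- x).  We take as coefficients the integers written as formal
-- differences (a , b) ↦ a - b of natural numbers: they map into every
-- ring, and equality of their images is decided by a + d ≟ c + b.

module RingSolver {c ℓ} (R : CommutativeRing c ℓ) where
  open import Algebra.Bundles using (RawRing)
  open import Algebra.Solver.Ring.AlmostCommutativeRing
    using (AlmostCommutativeRing; fromCommutativeRing; _-Raw-AlmostCommutative⟶_)
  open import Data.Maybe using (Maybe; nothing; just)
  import Data.Nat as ℕ
  open import Data.Product using (_,_) renaming (_×_ to _⊗_)
  open import Level using (0ℓ)
  open import Relation.Nullary using (yes; no)
  import Relation.Binary.PropositionalEquality as ≡
  open CommutativeRing R
  open import Algebra.Properties.Semiring.Mult semiring using (_×_; ×-homo-+; ×1-homo-*)
  open import Algebra.Properties.Ring ring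
    using (-0#≈0#; -‿involutive; -‿distribˡ-*; -‿distribʳ-*)
  open import Algebra.Properties.AbelianGroup +-abelianGroup using (⁻¹-∙-comm)
  open import Relation.Binary.Reasoning.Setoid setoid

  Differences : RawRing 0ℓ 0ℓ
  Differences = record
    { Carrier = ℕ ⊗ ℕ
    ; _≈_ = ≡._≡_
    ; _+_ = λ { (a , b) (a' , b') → (a ℕ.+ a' , b ℕ.+ b') }
    ; _*_ = λ { (a , b) (a' , b') → (a ℕ.* a' ℕ.+ b ℕ.* b' , a ℕ.* b' ℕ.+ b ℕ.* a') }
    ; -_ = λ { (a , b) → (b , a) }
    ; 0# = (0 , 0)
    ; 1# = (1 , 0)
    }

  ⟦_⟧ : ℕ ⊗ ℕ → Carrier
  ⟦ (a , b) ⟧ = a × 1# - b × 1#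

  swap-middle : ∀ w x y z → (w + x) + (y + z) ≈ (w + y) + (x + z)
  swap-middle w x y z = begin
    (w + x) + (y + z)  ≈⟨ +-assoc w x (y + z) ⟩
    w + (x + (y + z))  ≈⟨ +-cong refl (+-assoc x y z) ⟨
    w + ((x + y) + z)  ≈⟨ +-cong refl (+-cong (+-comm x y) refl) ⟩
    w + ((y + x) + z)  ≈⟨ +-cong refl (+-assoc y x z) ⟩
    w + (y + (x + z))  ≈⟨ +-assoc w y (x + z) ⟨
    (w + y) + (x + z)  ∎

  sub-+ : ∀ a b c d → (a + c) - (b + d) ≈ (a - b) + (c - d)
  sub-+ a b c d = begin
    (a + c) - (b + d)      ≈⟨ +-cong refl (⁻¹-∙-comm b d) ⟨
    (a + c) + (- b + - d)  ≈⟨ swap-middle a c (- b) (- d) ⟩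
    (a - b) + (c - d)      ∎

  sub-* : ∀ a b c d → ((a * c) + (b * d)) - ((a * d) + (b * c)) ≈ (a - b) * (c - d)
  sub-* a b c d = begin
    ((a * c) + (b * d)) - ((a * d) + (b * c))       ≈⟨ sub-+ (a * c) (a * d) (b * d) (b * c) ⟩
    (a * c - a * d) + (b * d - b * c)                ≈⟨ +-cong refl (+-cong (-‿involutive _) refl) ⟨
    (a * c - a * d) + (- - (b * d) - b * c)          ≈⟨ +-cong refl (+-comm _ _) ⟩
    (a * c - a * d) + (- (b * c) + - - (b * d))      ≈⟨ +-cong (+-cong refl (-‿distribʳ-* a d)) (+-cong (-‿distribˡ-* b c) (-‿cong (-‿distribʳ-* b d))) ⟩
    (a * c + a * - d) + (- b * c + - (b * - d))      ≈⟨ +-cong refl (+-cong refl (-‿distribˡ-* b (- d))) ⟩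
    (a * c + a * - d) + (- b * c + - b * - d)        ≈⟨ +-cong (distribˡ a c (- d)) (distribˡ (- b) c (- d)) ⟨
    a * (c - d) + - b * (c - d)                      ≈⟨ distribʳ (c - d) a (- b) ⟨
    (a - b) * (c - d)                                ∎

  cancel-+ : ∀ x y z → (x + z) - (y + z) ≈ x - y
  cancel-+ x y z = begin
    (x + z) - (y + z)      ≈⟨ sub-+ x y z z ⟩
    (x - y) + (z - z)      ≈⟨ +-cong refl (-‿inverseʳ z) ⟩
    (x - y) + 0#           ≈⟨ +-identityʳ _ ⟩
    x - y                  ∎

  ⟦⟧-resp : ∀ a b c d → a ℕ.+ d ≡.≡ c ℕ.+ b → ⟦ (a , b) ⟧ ≈ ⟦ (c , d) ⟧
  ⟦⟧-resp a b c d eq = begin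
    a × 1# - b × 1#                        ≈⟨ cancel-+ (a × 1#) (b × 1#) (d × 1#) ⟨
    (a × 1# + d × 1#) - (b × 1# + d × 1#)  ≈⟨ +-cong (×-homo-+ 1# a d) refl ⟨
    (a ℕ.+ d) × 1# - (b × 1# + d × 1#)     ≈⟨ +-cong (reflexive (≡.cong (_× 1#) eq)) refl ⟩
    (c ℕ.+ b) × 1# - (b × 1# + d × 1#)     ≈⟨ +-cong (×-homo-+ 1# c b) (-‿cong (+-comm _ _)) ⟩
    (c × 1# + b × 1#) - (d × 1# + b × 1#)  ≈⟨ cancel-+ (c × 1#) (d × 1#) (b × 1#) ⟩
    c × 1# - d × 1#                        ∎

  ACR : AlmostCommutativeRing c ℓ
  ACR = fromCommutativeRing R

  differences⟶R : Differences -Raw-AlmostCommutative⟶ ACR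
  differences⟶R = record
    { ⟦_⟧ = ⟦_⟧
    ; +-homo = λ { (a , b) (a' , b') →
        trans (+-cong (×-homo-+ 1# a a') (-‿cong (×-homo-+ 1# b b'))) (sub-+ _ _ _ _) }
    ; *-homo = λ { (a , b) (a' , b') →
        trans (+-cong (trans (×-homo-+ 1# (a ℕ.* a') (b ℕ.* b')) (+-cong (×1-homo-* a a') (×1-homo-* b b')))
                      (-‿cong (trans (×-homo-+ 1# (a ℕ.* b') (b ℕ.* a')) (+-cong (×1-homo-* a b') (×1-homo-* b a')))))
              (sub-* _ _ _ _) }
    ; -‿homo = λ { (a , b) → trans (trans (+-cong (sym (-‿involutive _)) refl) (⁻¹-∙-comm _ _)) (-‿cong (+-comm _ _)) }
    ; 0-homo = trans (+-cong refl -0#≈0#) (+-identityʳ 0#)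
    ; 1-homo = trans (+-cong (+-identityʳ 1#) -0#≈0#) (+-identityʳ 1#)
    }

  differences≟ : ∀ x y → Maybe (⟦ x ⟧ ≈ ⟦ y ⟧)
  differences≟ (a , b) (c , d) with a ℕ.+ d ℕ.≟ c ℕ.+ b
  ... | yes e = just (⟦⟧-resp a b c d e)
  ... | no _  = nothing

  open import Algebra.Solver.Ring Differences ACR differences⟶R differences≟ public
    using (solve; _:=_; _:+_; _:*_; _:-_; :-_)

-- Equality of polynomials is coefficientwise equality (Defs' _≈ₚ_),
-- wrapped in a record so that Agda can infer the polynomials involved.

module PolynomialRing {c ℓ} (R : CommutativeRing c ℓ) where
  open import Data.Nat using (zero; suc)
  open import Data.List using ([]; _∷_)
  open import Data.Product using (_,_)
  open CommutativeRing R hiding (zero)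
  open Poly R
  open import Algebra.Properties.Ring ring using (-1*x≈-x)

  infix 4 _≋_
  record _≋_ (p q : Pol) : Set ℓ where
    constructor mk
    field get : p ≈ₚ q
  open _≋_ public

  ≋-refl : ∀ {p} → p ≋ p
  ≋-refl = mk λ i → refl

  ≋-sym : ∀ {p q} → p ≋ q → q ≋ p
  ≋-sym E = mk λ i → sym (get E i)

  ≋-trans : ∀ {p q r} → p ≋ q → q ≋ r → p ≋ r
  ≋-trans E F = mk λ i → trans (get E i) (get F i)

  coeff-+ : ∀ p q i → coeff (p +ₚ q) i ≈ coeff p i + coeff q i
  coeff-+ []      q       i       = sym (+-identityˡ _)
  coeff-+ (a ∷ p) []      i       = sym (+-identityʳ _)
  coeff-+ (a ∷ p) (b ∷ q) zero    = refl
  coeff-+ (a ∷ p) (b ∷ q) (suc i) = coeff-+ p q i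

  coeff-· : ∀ a p i → coeff (a ·ₚ p) i ≈ a * coeff p i
  coeff-· a []      i       = sym (zeroʳ a)
  coeff-· a (b ∷ p) zero    = refl
  coeff-· a (b ∷ p) (suc i) = coeff-· a p i

  ∷-cong : ∀ {a b p q} → a ≈ b → p ≋ q → (a ∷ p) ≋ (b ∷ q)
  ∷-cong e E = mk λ { zero → e ; (suc i) → get E i }

  ∷-tail : ∀ {a b p q} → (a ∷ p) ≋ (b ∷ q) → p ≋ q
  ∷-tail E = mk λ i → get E (suc i)

  ∷-zero : ∀ {a p} → a ≈ 0# → p ≋ [] → (a ∷ p) ≋ []
  ∷-zero e E = mk λ { zero → e ; (suc i) → get E i }

  ∷-zero-tail : ∀ {a p} → (a ∷ p) ≋ [] → p ≋ []
  ∷-zero-tail E = mk λ i → get E (suc i)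

  +ₚ-cong : ∀ {p p' q q'} → p ≋ p' → q ≋ q' → (p +ₚ q) ≋ (p' +ₚ q')
  +ₚ-cong {p} {p'} {q} {q'} E F =
    mk λ i → trans (coeff-+ p q i) (trans (+-cong (get E i) (get F i)) (sym (coeff-+ p' q' i)))

  ·ₚ-cong : ∀ {a b p q} → a ≈ b → p ≋ q → (a ·ₚ p) ≋ (b ·ₚ q)
  ·ₚ-cong {a} {b} {p} {q} e E =
    mk λ i → trans (coeff-· a p i) (trans (*-cong e (get E i)) (sym (coeff-· b q i)))

  ·ₚ-zero : ∀ {a} p → a ≈ 0# → (a ·ₚ p) ≋ []
  ·ₚ-zero {a} p e = mk λ i → trans (coeff-· a p i) (trans (*-cong e refl) (zeroˡ _))

  +ₚ-identityʳ : ∀ p → (p +ₚ []) ≋ p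
  +ₚ-identityʳ []      = ≋-refl
  +ₚ-identityʳ (a ∷ p) = ≋-refl

  +ₚ-comm : ∀ p q → (p +ₚ q) ≋ (q +ₚ p)
  +ₚ-comm p q = mk λ i → trans (coeff-+ p q i) (trans (+-comm _ _) (sym (coeff-+ q p i)))

  +ₚ-assoc : ∀ p q r → ((p +ₚ q) +ₚ r) ≋ (p +ₚ (q +ₚ r))
  +ₚ-assoc p q r = mk λ i →
    trans (coeff-+ (p +ₚ q) r i) (trans (+-cong (coeff-+ p q i) refl) (trans (+-assoc _ _ _)
      (sym (trans (coeff-+ p (q +ₚ r) i) (+-cong refl (coeff-+ q r i))))))

  negₚ-inverseʳ : ∀ p → (p +ₚ negₚ p) ≋ []
  negₚ-inverseʳ p = mk λ i →
    trans (coeff-+ p (negₚ p) i) (trans (+-cong refl (trans (coeff-· (- 1#) p i) (-1*x≈-x _))) (-‿inverseʳ _))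

  negₚ-cong : ∀ {p q} → p ≋ q → negₚ p ≋ negₚ q
  negₚ-cong = ·ₚ-cong refl

  +ₚ-interchange : ∀ p q r s → ((p +ₚ q) +ₚ (r +ₚ s)) ≋ ((p +ₚ r) +ₚ (q +ₚ s))
  +ₚ-interchange p q r s = mk λ i →
    trans (coeff-+ (p +ₚ q) (r +ₚ s) i) (trans (+-cong (coeff-+ p q i) (coeff-+ r s i))
      (trans (RS.swap-middle _ _ _ _)
        (sym (trans (coeff-+ (p +ₚ r) (q +ₚ s) i) (+-cong (coeff-+ p r i) (coeff-+ q s i))))))
    where module RS = RingSolver R

  ·ₚ-distribʳ : ∀ a b p → ((a + b) ·ₚ p) ≋ ((a ·ₚ p) +ₚ (b ·ₚ p))
  ·ₚ-distribʳ a b p = mk λ i →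
    trans (coeff-· (a + b) p i) (trans (distribʳ _ a b)
      (sym (trans (coeff-+ (a ·ₚ p) (b ·ₚ p) i) (+-cong (coeff-· a p i) (coeff-· b p i)))))

  ·ₚ-distribˡ : ∀ a p q → (a ·ₚ (p +ₚ q)) ≋ ((a ·ₚ p) +ₚ (a ·ₚ q))
  ·ₚ-distribˡ a p q = mk λ i →
    trans (coeff-· a (p +ₚ q) i) (trans (*-cong refl (coeff-+ p q i)) (trans (distribˡ a _ _)
      (sym (trans (coeff-+ (a ·ₚ p) (a ·ₚ q) i) (+-cong (coeff-· a p i) (coeff-· a q i))))))

  ·ₚ-assoc : ∀ a b p → ((a * b) ·ₚ p) ≋ (a ·ₚ (b ·ₚ p))
  ·ₚ-assoc a b p = mk λ i →
    trans (coeff-· (a * b) p i) (trans (*-assoc _ _ _) (sym (trans (coeff-· a (b ·ₚ p) i) (*-cong refl (coeff-· b p i)))))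

  ·ₚ-identity : ∀ p → (1# ·ₚ p) ≋ p
  ·ₚ-identity p = mk λ i → trans (coeff-· 1# p i) (*-identityˡ _)

  *ₚ-zeroˡ : ∀ p q → p ≋ [] → (p *ₚ q) ≋ []
  *ₚ-zeroˡ []      q E = ≋-refl
  *ₚ-zeroˡ (a ∷ p) q E = +ₚ-cong (·ₚ-zero q (get E zero)) (∷-zero refl (*ₚ-zeroˡ p q (∷-zero-tail E)))

  *ₚ-zeroʳ : ∀ p → (p *ₚ []) ≋ []
  *ₚ-zeroʳ []      = ≋-refl
  *ₚ-zeroʳ (a ∷ p) = ∷-zero refl (*ₚ-zeroʳ p)

  *ₚ-congˡ : ∀ {p p'} q → p ≋ p' → (p *ₚ q) ≋ (p' *ₚ q)
  *ₚ-congˡ {[]}    {[]}     q E = ≋-refl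
  *ₚ-congˡ {[]}    {b ∷ p'} q E = ≋-sym (*ₚ-zeroˡ (b ∷ p') q (≋-sym E))
  *ₚ-congˡ {a ∷ p} {[]}     q E = *ₚ-zeroˡ (a ∷ p) q E
  *ₚ-congˡ {a ∷ p} {b ∷ p'} q E = +ₚ-cong (·ₚ-cong (get E zero) ≋-refl) (∷-cong refl (*ₚ-congˡ q (∷-tail E)))

  *ₚ-congʳ : ∀ p {q q'} → q ≋ q' → (p *ₚ q) ≋ (p *ₚ q')
  *ₚ-congʳ []      E = ≋-refl
  *ₚ-congʳ (a ∷ p) E = +ₚ-cong (·ₚ-cong refl E) (∷-cong refl (*ₚ-congʳ p E))

  *ₚ-cong : ∀ {p p' q q'} → p ≋ p' → q ≋ q' → (p *ₚ q) ≋ (p' *ₚ q')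
  *ₚ-cong {p' = p'} {q} E F = ≋-trans (*ₚ-congˡ q E) (*ₚ-congʳ p' F)

  0∷-+ : ∀ p q → (0# ∷ (p +ₚ q)) ≋ ((0# ∷ p) +ₚ (0# ∷ q))
  0∷-+ p q = ∷-cong (sym (+-identityʳ 0#)) ≋-refl

  *ₚ-distribʳ : ∀ p q r → ((p +ₚ q) *ₚ r) ≋ ((p *ₚ r) +ₚ (q *ₚ r))
  *ₚ-distribʳ []      q       r = ≋-refl
  *ₚ-distribʳ (a ∷ p) []      r = ≋-sym (+ₚ-identityʳ _)
  *ₚ-distribʳ (a ∷ p) (b ∷ q) r =
    ≋-trans (+ₚ-cong (·ₚ-distribʳ a b r) (≋-trans (∷-cong refl (*ₚ-distribʳ p q r)) (0∷-+ (p *ₚ r) (q *ₚ r))))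
            (+ₚ-interchange (a ·ₚ r) (b ·ₚ r) (0# ∷ (p *ₚ r)) (0# ∷ (q *ₚ r)))

  *ₚ-distribˡ : ∀ p q r → (p *ₚ (q +ₚ r)) ≋ ((p *ₚ q) +ₚ (p *ₚ r))
  *ₚ-distribˡ []      q r = ≋-refl
  *ₚ-distribˡ (a ∷ p) q r =
    ≋-trans (+ₚ-cong (·ₚ-distribˡ a q r) (≋-trans (∷-cong refl (*ₚ-distribˡ p q r)) (0∷-+ (p *ₚ q) (p *ₚ r))))
            (+ₚ-interchange (a ·ₚ q) (a ·ₚ r) (0# ∷ (p *ₚ q)) (0# ∷ (p *ₚ r)))

  *ₚ-∷ : ∀ q a p → (q *ₚ (a ∷ p)) ≋ ((a ·ₚ q) +ₚ (0# ∷ (q *ₚ p)))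
  *ₚ-∷ []      a p = ≋-sym (∷-zero refl ≋-refl)
  *ₚ-∷ (b ∷ q) a p = ∷-cong (+-cong (*-comm b a) refl)
    (≋-trans (+ₚ-cong (≋-refl {b ·ₚ p}) (*ₚ-∷ q a p))
      (≋-trans (≋-sym (+ₚ-assoc (b ·ₚ p) (a ·ₚ q) _))
        (≋-trans (+ₚ-cong (+ₚ-comm (b ·ₚ p) (a ·ₚ q)) ≋-refl) (+ₚ-assoc (a ·ₚ q) (b ·ₚ p) _))))

  *ₚ-comm : ∀ p q → (p *ₚ q) ≋ (q *ₚ p)
  *ₚ-comm []      q = ≋-sym (*ₚ-zeroʳ q)
  *ₚ-comm (a ∷ p) q = ≋-trans (+ₚ-cong (≋-refl {a ·ₚ q}) (∷-cong refl (*ₚ-comm p q))) (≋-sym (*ₚ-∷ q a p))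

  ·ₚ-*ₚ : ∀ a p q → ((a ·ₚ p) *ₚ q) ≋ (a ·ₚ (p *ₚ q))
  ·ₚ-*ₚ a []      q = ≋-refl
  ·ₚ-*ₚ a (b ∷ p) q = ≋-trans (+ₚ-cong (·ₚ-assoc a b q) (∷-cong (sym (zeroʳ a)) (·ₚ-*ₚ a p q)))
                              (≋-sym (·ₚ-distribˡ a (b ·ₚ q) (0# ∷ (p *ₚ q))))

  0∷-*ₚ : ∀ p q → ((0# ∷ p) *ₚ q) ≋ (0# ∷ (p *ₚ q))
  0∷-*ₚ p q = +ₚ-cong (·ₚ-zero q refl) (≋-refl {0# ∷ (p *ₚ q)})

  *ₚ-assoc : ∀ p q r → ((p *ₚ q) *ₚ r) ≋ (p *ₚ (q *ₚ r))
  *ₚ-assoc []      q r = ≋-refl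
  *ₚ-assoc (a ∷ p) q r =
    ≋-trans (*ₚ-distribʳ (a ·ₚ q) (0# ∷ (p *ₚ q)) r)
      (+ₚ-cong (·ₚ-*ₚ a q r) (≋-trans (0∷-*ₚ (p *ₚ q) r) (∷-cong refl (*ₚ-assoc p q r))))

  1ₚ : Pol
  1ₚ = const 1#

  *ₚ-identityˡ : ∀ p → (1ₚ *ₚ p) ≋ p
  *ₚ-identityˡ p = ≋-trans (+ₚ-cong (·ₚ-identity p) (∷-zero refl ≋-refl)) (+ₚ-identityʳ p)

  polyRing : CommutativeRing c ℓ
  polyRing = record
    { Carrier = Pol ; _≈_ = _≋_ ; _+_ = _+ₚ_ ; _*_ = _*ₚ_ ; -_ = negₚ ; 0# = [] ; 1# = 1ₚ
    ; isCommutativeRing = record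
      { isRing = record
        { +-isAbelianGroup = record
          { isGroup = record
            { isMonoid = record
              { isSemigroup = record
                { isMagma = record
                  { isEquivalence = record { refl = ≋-refl ; sym = ≋-sym ; trans = ≋-trans }
                  ; ∙-cong = +ₚ-cong }
                ; assoc = +ₚ-assoc }
              ; identity = (λ p → ≋-refl) , +ₚ-identityʳ }
            ; inverse = (λ p → ≋-trans (+ₚ-comm (negₚ p) p) (negₚ-inverseʳ p)) , negₚ-inverseʳ
            ; ⁻¹-cong = negₚ-cong }
          ; comm = +ₚ-comm }
        ; *-cong = *ₚ-cong
        ; *-assoc = *ₚ-assoc
        ; *-identity = *ₚ-identityˡ , (λ p → ≋-trans (*ₚ-comm p 1ₚ) (*ₚ-identityˡ p))
        ; distrib = *ₚ-distribˡ , (λ p q r → *ₚ-distribʳ q r p) }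
      ; *-comm = *ₚ-comm } }

  module PolySolver = RingSolver polyRing

module Composition {c ℓ} (R : CommutativeRing c ℓ) where
  open import Data.Nat using (zero; suc)
  open import Data.List using ([]; _∷_)
  open CommutativeRing R hiding (zero)
  open Poly R
  open PolynomialRing R
  open PolySolver using (solve; _:=_; _:+_; _:*_; _:-_)
  open import Algebra.Properties.Ring ring using (-1*x≈-x)
  module Solver = RingSolver R

  X*ₚ : ∀ p → (X *ₚ p) ≋ (0# ∷ p)
  X*ₚ p = +ₚ-cong (·ₚ-zero p refl) (∷-cong refl (*ₚ-identityˡ p))

  const*ₚ : ∀ a p → (const a *ₚ p) ≋ (a ·ₚ p)
  const*ₚ a p = ≋-trans (+ₚ-cong (≋-refl {a ·ₚ p}) (∷-zero refl ≋-refl)) (+ₚ-identityʳ _)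

  const-* : ∀ a b → const (a * b) ≋ (const a *ₚ const b)
  const-* a b = ≋-sym (const*ₚ a (const b))

  const-zero : ∀ {a} → a ≈ 0# → const a ≋ []
  const-zero e = ∷-zero e ≋-refl

  const-one : ∀ {a} → a ≈ 1# → const a ≋ 1ₚ
  const-one e = ∷-cong e ≋-refl

  horner : ∀ a p → (a ∷ p) ≋ (const a +ₚ (X *ₚ p))
  horner a p = ≋-sym (≋-trans (+ₚ-cong (≋-refl {const a}) (X*ₚ p)) (∷-cong (+-identityʳ a) ≋-refl))

  const-∘ : ∀ a r → (const a ∘ₚ r) ≋ const a
  const-∘ a r = ≋-trans (+ₚ-cong (≋-refl {const a}) (*ₚ-zeroʳ r)) (+ₚ-identityʳ _)

  ∘-zero : ∀ p r → p ≋ [] → (p ∘ₚ r) ≋ []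
  ∘-zero []      r E = ≋-refl
  ∘-zero (a ∷ p) r E =
    +ₚ-cong (const-zero (get E zero)) (≋-trans (*ₚ-congʳ r (∘-zero p r (∷-zero-tail E))) (*ₚ-zeroʳ r))

  ∘-congˡ : ∀ {p p'} r → p ≋ p' → (p ∘ₚ r) ≋ (p' ∘ₚ r)
  ∘-congˡ {[]}    {[]}     r E = ≋-refl
  ∘-congˡ {[]}    {b ∷ p'} r E = ≋-sym (∘-zero (b ∷ p') r (≋-sym E))
  ∘-congˡ {a ∷ p} {[]}     r E = ∘-zero (a ∷ p) r E
  ∘-congˡ {a ∷ p} {b ∷ p'} r E = +ₚ-cong (∷-cong (get E zero) ≋-refl) (*ₚ-congʳ r (∘-congˡ r (∷-tail E)))

  ∘-congʳ : ∀ p {q q'} → q ≋ q' → (p ∘ₚ q) ≋ (p ∘ₚ q')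
  ∘-congʳ []      E = ≋-refl
  ∘-congʳ (a ∷ p) E = +ₚ-cong (≋-refl {const a}) (*ₚ-cong E (∘-congʳ p E))

  +ₚ-∘ : ∀ p q r → ((p +ₚ q) ∘ₚ r) ≋ ((p ∘ₚ r) +ₚ (q ∘ₚ r))
  +ₚ-∘ []      q       r = ≋-refl
  +ₚ-∘ (a ∷ p) []      r = ≋-sym (+ₚ-identityʳ _)
  +ₚ-∘ (a ∷ p) (b ∷ q) r =
    ≋-trans (+ₚ-cong (≋-refl {const (a + b)}) (*ₚ-congʳ r (+ₚ-∘ p q r)))
      (solve 5 (λ A B r P Q → (A :+ B) :+ r :* (P :+ Q) := (A :+ r :* P) :+ (B :+ r :* Q))
             ≋-refl (const a) (const b) r (p ∘ₚ r) (q ∘ₚ r))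

  ·ₚ-∘ : ∀ a p r → ((a ·ₚ p) ∘ₚ r) ≋ (const a *ₚ (p ∘ₚ r))
  ·ₚ-∘ a []      r = ≋-sym (*ₚ-zeroʳ (const a))
  ·ₚ-∘ a (b ∷ p) r =
    ≋-trans (+ₚ-cong (const-* a b) (*ₚ-congʳ r (·ₚ-∘ a p r)))
      (solve 4 (λ A B r P → A :* B :+ r :* (A :* P) := A :* (B :+ r :* P)) ≋-refl (const a) (const b) r (p ∘ₚ r))

  negₚ-∘ : ∀ p r → (negₚ p ∘ₚ r) ≋ negₚ (p ∘ₚ r)
  negₚ-∘ p r = ≋-trans (·ₚ-∘ (- 1#) p r) (const*ₚ (- 1#) _)

  *ₚ-∘ : ∀ p q r → ((p *ₚ q) ∘ₚ r) ≋ ((p ∘ₚ r) *ₚ (q ∘ₚ r))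
  *ₚ-∘ []      q r = ≋-refl
  *ₚ-∘ (a ∷ p) q r = ≋-trans (+ₚ-∘ (a ·ₚ q) (0# ∷ (p *ₚ q)) r)
    (≋-trans (+ₚ-cong (·ₚ-∘ a q r) (≋-trans shift (*ₚ-congʳ r (*ₚ-∘ p q r))))
      (solve 4 (λ A Q r P → A :* Q :+ r :* (P :* Q) := (A :+ r :* P) :* Q) ≋-refl (const a) (q ∘ₚ r) r (p ∘ₚ r)))
    where
    shift : ((0# ∷ (p *ₚ q)) ∘ₚ r) ≋ (r *ₚ ((p *ₚ q) ∘ₚ r))
    shift = +ₚ-cong (const-zero refl) ≋-refl

  ∘-assoc : ∀ p q r → ((p ∘ₚ q) ∘ₚ r) ≋ (p ∘ₚ (q ∘ₚ r))
  ∘-assoc []      q r = ≋-refl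
  ∘-assoc (a ∷ p) q r = ≋-trans (+ₚ-∘ (const a) (q *ₚ (p ∘ₚ q)) r)
    (+ₚ-cong (const-∘ a r) (≋-trans (*ₚ-∘ q (p ∘ₚ q) r) (*ₚ-congʳ (q ∘ₚ r) (∘-assoc p q r))))

  ∘-X : ∀ p → (p ∘ₚ X) ≋ p
  ∘-X []      = ≋-refl
  ∘-X (a ∷ p) = ≋-trans (+ₚ-cong (≋-refl {const a}) (*ₚ-congʳ X (∘-X p))) (≋-sym (horner a p))

  X-∘ : ∀ r → (X ∘ₚ r) ≋ r
  X-∘ r = ≋-trans (+ₚ-cong (const-zero refl) (*ₚ-congʳ r (const-∘ 1# r)))
                  (≋-trans (*ₚ-comm r 1ₚ) (*ₚ-identityˡ r))

  const-reflect : ∀ a T T' → (T ∘ₚ T') ≋ X → IsConstant (a ∘ₚ T) → IsConstant a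
  const-reflect a T T' TT' isConst i = get a≋const (suc i)
    where
    b = coeff (a ∘ₚ T) 0
    a≋const : a ≋ const b
    a≋const = ≋-trans (≋-sym (∘-X a)) (≋-trans (∘-congʳ a (≋-sym TT')) (≋-trans (≋-sym (∘-assoc a T T'))
                (≋-trans (∘-congˡ {a ∘ₚ T} {const b} T' (mk λ { zero → refl ; (suc i) → isConst i })) (const-∘ b T'))))

  x² : Pol
  x² = X *ₚ X

  translate-∘ : ∀ a r → ((X +ₚ const a) ∘ₚ r) ≋ (r +ₚ const a)
  translate-∘ a r = ≋-trans (+ₚ-∘ X (const a) r) (+ₚ-cong (X-∘ r) (const-∘ a r))

  untranslate-∘ : ∀ a r → ((X -ₚ const a) ∘ₚ r) ≋ (r -ₚ const a)
  untranslate-∘ a r = ≋-trans (+ₚ-∘ X (negₚ (const a)) r)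
    (+ₚ-cong (X-∘ r) (≋-trans (negₚ-∘ (const a) r) (negₚ-cong (const-∘ a r))))

  translate-untranslate : ∀ a → ((X +ₚ const a) ∘ₚ (X -ₚ const a)) ≋ X
  translate-untranslate a = ≋-trans (translate-∘ a (X -ₚ const a))
    (solve 2 (λ x a → (x :- a) :+ a := x) ≋-refl X (const a))

  untranslate-translate : ∀ a → ((X -ₚ const a) ∘ₚ (X +ₚ const a)) ≋ X
  untranslate-translate a = ≋-trans (untranslate-∘ a (X +ₚ const a))
    (solve 2 (λ x a → (x :+ a) :- a := x) ≋-refl X (const a))

  translate-nonconstant : ∀ a A → ¬ IsConstant A → ¬ IsConstant (A ∘ₚ (X +ₚ const a))
  translate-nonconstant a A nonconst = nonconst ∘′ const-reflect A (X +ₚ const a) (X -ₚ const a) (translate-untranslate a)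
    where open import Function using (_∘′_)

  eval-+ : ∀ p q x → eval (p +ₚ q) x ≈ eval p x + eval q x
  eval-+ []      q       x = sym (+-identityˡ _)
  eval-+ (a ∷ p) []      x = sym (+-identityʳ _)
  eval-+ (a ∷ p) (b ∷ q) x = trans (+-cong refl (*-cong refl (eval-+ p q x)))
    (Solver.solve 5 (λ a b x P Q → (a Solver.:+ b) Solver.:+ x Solver.:* (P Solver.:+ Q)
                                   Solver.:= (a Solver.:+ x Solver.:* P) Solver.:+ (b Solver.:+ x Solver.:* Q))
                  refl a b x (eval p x) (eval q x))

  eval-· : ∀ a p x → eval (a ·ₚ p) x ≈ a * eval p x
  eval-· a []      x = sym (zeroʳ a)
  eval-· a (b ∷ p) x = trans (+-cong refl (*-cong refl (eval-· a p x)))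
    (Solver.solve 4 (λ a b x P → a Solver.:* b Solver.:+ x Solver.:* (a Solver.:* P)
                                 Solver.:= a Solver.:* (b Solver.:+ x Solver.:* P))
                  refl a b x (eval p x))

  eval-* : ∀ p q x → eval (p *ₚ q) x ≈ eval p x * eval q x
  eval-* []      q x = sym (zeroˡ _)
  eval-* (a ∷ p) q x = trans (eval-+ (a ·ₚ q) (0# ∷ (p *ₚ q)) x)
    (trans (+-cong (eval-· a q x) (trans (+-identityˡ _) (*-cong refl (eval-* p q x))))
      (Solver.solve 4 (λ a x P Q → a Solver.:* Q Solver.:+ x Solver.:* (P Solver.:* Q)
                                   Solver.:= (a Solver.:+ x Solver.:* P) Solver.:* Q)
                    refl a x (eval p x) (eval q x)))

  eval-const : ∀ a x → eval (const a) x ≈ a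
  eval-const a x = trans (+-cong refl (zeroʳ x)) (+-identityʳ a)

  eval-X : ∀ x → eval X x ≈ x
  eval-X x = trans (+-identityˡ _) (trans (*-cong refl (eval-const 1# x)) (*-identityʳ x))

  eval--ₚ : ∀ p q x → eval (p -ₚ q) x ≈ eval p x - eval q x
  eval--ₚ p q x = trans (eval-+ p (negₚ q) x) (+-cong refl (trans (eval-· (- 1#) q x) (-1*x≈-x _)))

  eval-∘ : ∀ p q x → eval (p ∘ₚ q) x ≈ eval p (eval q x)
  eval-∘ []      q x = refl
  eval-∘ (a ∷ p) q x = trans (eval-+ (const a) (q *ₚ (p ∘ₚ q)) x)
    (+-cong (eval-const a x) (trans (eval-* q (p ∘ₚ q) x) (*-cong refl (eval-∘ p q x))))

  eval-congʳ : ∀ p {x y} → x ≈ y → eval p x ≈ eval p y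
  eval-congʳ []      e = refl
  eval-congʳ (a ∷ p) e = +-cong refl (*-cong e (eval-congʳ p e))

  coeff₀-* : ∀ p q → coeff (p *ₚ q) 0 ≈ coeff p 0 * coeff q 0
  coeff₀-* []      q = sym (zeroˡ _)
  coeff₀-* (a ∷ p) q = trans (coeff-+ (a ·ₚ q) (0# ∷ (p *ₚ q)) 0) (trans (+-identityʳ _) (coeff-· a q 0))

  coeff₀-∘ : ∀ p q → coeff (p ∘ₚ q) 0 ≈ eval p (coeff q 0)
  coeff₀-∘ []      q = refl
  coeff₀-∘ (a ∷ p) q = trans (coeff-+ (const a) (q *ₚ (p ∘ₚ q)) 0)
    (+-cong refl (trans (coeff₀-* q (p ∘ₚ q)) (*-cong refl (coeff₀-∘ p q))))

-- Fields with decidable equality.  Number fields are such fields (see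
-- 'NumberFieldFacts.decField'); degree arguments need the decision.

record DecField {c ℓ} (R : CommutativeRing c ℓ) : Set (c Level.⊔ ℓ) where
  open CommutativeRing R using (_≈_; _*_; 0#; 1#)
  field
    1≉0     : ¬ (1# ≈ 0#)
    inverse : ∀ x → ¬ (x ≈ 0#) → ∃ λ y → x * y ≈ 1#
    zero?   : ∀ x → Dec (x ≈ 0#)

TwoNonzero : ∀ {c ℓ} → CommutativeRing c ℓ → Set ℓ
TwoNonzero R = ¬ (1# + 1# ≈ 0#)
  where open CommutativeRing R using (_≈_; _+_; 0#; 1#)

module Degrees {c ℓ} (R : CommutativeRing c ℓ) (F : DecField R) where
  open import Data.Nat as ℕ using (zero; suc; z≤n; s≤s; _<_; _≤?_)
  import Data.Nat.Properties as ℕ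
  open import Data.List using ([]; _∷_; length)
  open import Data.Product using (_,_; proj₁; proj₂; _×_)
  open import Data.Sum using (_⊎_; inj₁; inj₂)
  open import Data.Empty using (⊥-elim)
  open import Relation.Nullary using (yes; no)
  import Relation.Binary.PropositionalEquality as ≡
  open CommutativeRing R hiding (zero)
  open DecField F
  open Poly R
  open PolynomialRing R
  open Composition R

  record Vanishes (p : Pol) (n : ℕ) : Set ℓ where
    constructor vanishes
    field vanish : ∀ i → n ≤ i → coeff p i ≈ 0#
  open Vanishes public

  Deg : Pol → ℕ → Set ℓ
  Deg p k = Vanishes p (suc k) × ¬ (coeff p k ≈ 0#)

  Monic : Pol → ℕ → Set ℓ
  Monic p k = Vanishes p (suc k) × (coeff p k ≈ 1#)

  coeff-≡ : ∀ p {i j} → i ≡.≡ j → coeff p i ≈ coeff p j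
  coeff-≡ p ≡.refl = refl

  Vanishes-tail : ∀ {a p n} → Vanishes (a ∷ p) (suc n) → Vanishes p n
  Vanishes-tail V = vanishes λ i n≤i → vanish V (suc i) (s≤s n≤i)

  Vanishes-∷ : ∀ {a p n} → Vanishes p n → Vanishes (a ∷ p) (suc n)
  Vanishes-∷ V = vanishes λ { zero () ; (suc i) (s≤s n≤i) → vanish V i n≤i }

  Vanishes-mono : ∀ {p n m} → Vanishes p n → n ≤ m → Vanishes p m
  Vanishes-mono V n≤m = vanishes λ i m≤i → vanish V i (ℕ.≤-trans n≤m m≤i)

  Vanishes-cong : ∀ {p q n} → p ≋ q → Vanishes p n → Vanishes q n
  Vanishes-cong E V = vanishes λ i n≤i → trans (sym (get E i)) (vanish V i n≤i)

  Vanishes-zero : ∀ {p} → Vanishes p 0 → p ≋ []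
  Vanishes-zero V = mk λ i → vanish V i z≤n

  Vanishes-length : ∀ p → Vanishes p (length p)
  Vanishes-length []      = vanishes λ i _ → refl
  Vanishes-length (a ∷ p) = Vanishes-∷ (Vanishes-length p)

  Vanishes-+ : ∀ {p q n} → Vanishes p n → Vanishes q n → Vanishes (p +ₚ q) n
  Vanishes-+ {p} {q} Vp Vq = vanishes λ i n≤i →
    trans (coeff-+ p q i) (trans (+-cong (vanish Vp i n≤i) (vanish Vq i n≤i)) (+-identityʳ 0#))

  Vanishes-· : ∀ {a p n} → Vanishes p n → Vanishes (a ·ₚ p) n
  Vanishes-· {a} {p} V = vanishes λ i n≤i → trans (coeff-· a p i) (trans (*-cong refl (vanish V i n≤i)) (zeroʳ a))

  Vanishes-const : ∀ a → Vanishes (const a) 1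
  Vanishes-const a = vanishes λ { zero () ; (suc i) _ → refl }

  const-coeff₀ : ∀ {a} → IsConstant a → a ≋ const (coeff a 0)
  const-coeff₀ isConst = mk λ { zero → refl ; (suc i) → isConst i }

  Deg-nonzero : ∀ {p k} → Deg p k → ¬ (p ≋ [])
  Deg-nonzero D E = proj₂ D (get E _)

  Deg-cong : ∀ {p q k} → p ≋ q → Deg p k → Deg q k
  Deg-cong E (V , nz) = Vanishes-cong E V , λ z → nz (trans (get E _) z)

  Deg-< : ∀ {p k n} → Deg p k → Vanishes p n → k < n
  Deg-< {k = k} {n} (_ , nz) V with suc k ≤? n
  ... | yes k<n = k<n
  ... | no  k≮n = ⊥-elim (nz (vanish V k (ℕ.≤-pred (ℕ.≰⇒> k≮n))))

  Deg-unique : ∀ {p k k'} → Deg p k → Deg p k' → k ≡.≡ k'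
  Deg-unique D D' = ℕ.≤-antisym (ℕ.≤-pred (Deg-< D (proj₁ D'))) (ℕ.≤-pred (Deg-< D' (proj₁ D)))

  Monic⇒Deg : ∀ {p k} → Monic p k → Deg p k
  Monic⇒Deg (V , e) = V , λ z → 1≉0 (trans (sym e) z)

  Monic-cong : ∀ {p q k} → p ≋ q → Monic p k → Monic q k
  Monic-cong E (V , e) = Vanishes-cong E V , trans (sym (get E _)) e

  degree? : ∀ p → (p ≋ []) ⊎ (∃ λ k → Deg p k)
  degree? []      = inj₁ ≋-refl
  degree? (a ∷ p) with degree? p
  ... | inj₂ (k , V , nz) = inj₂ (suc k , Vanishes-∷ V , nz)
  ... | inj₁ p≋0 with zero? a
  ...   | yes a≈0 = inj₁ (∷-zero a≈0 p≋0)
  ...   | no  a≉0 = inj₂ (0 , Vanishes-∷ (vanishes λ i _ → get p≋0 i) , a≉0)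

  nonzero-* : ∀ {x y} → ¬ (x ≈ 0#) → ¬ (y ≈ 0#) → ¬ (x * y ≈ 0#)
  nonzero-* {x} {y} x≉0 y≉0 xy≈0 with inverse x x≉0
  ... | (x⁻¹ , xx⁻¹≈1) = y≉0 (begin
    y                ≈⟨ *-identityˡ y ⟨
    1# * y           ≈⟨ *-cong xx⁻¹≈1 refl ⟨
    (x * x⁻¹) * y    ≈⟨ *-cong (*-comm x x⁻¹) refl ⟩
    (x⁻¹ * x) * y    ≈⟨ *-assoc x⁻¹ x y ⟩
    x⁻¹ * (x * y)    ≈⟨ *-cong refl xy≈0 ⟩
    x⁻¹ * 0#         ≈⟨ zeroʳ x⁻¹ ⟩
    0#               ∎)
    where open import Relation.Binary.Reasoning.Setoid setoid

  top-coeff-* : ∀ p k q l → Vanishes p (suc k) → Vanishes q (suc l) →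
                Vanishes (p *ₚ q) (suc (k ℕ.+ l)) × (coeff (p *ₚ q) (k ℕ.+ l) ≈ coeff p k * coeff q l)
  top-coeff-* []      k       q l Vp Vq = vanishes (λ i _ → refl) , sym (zeroˡ _)
  top-coeff-* (a ∷ p) zero    q l Vp Vq =
    vanishes (λ i l<i → trans (scaled i) (trans (*-cong refl (vanish Vq i l<i)) (zeroʳ a))) , scaled l
    where
    scaled : ∀ i → coeff ((a ∷ p) *ₚ q) i ≈ a * coeff q i
    scaled i = trans (coeff-+ (a ·ₚ q) (0# ∷ (p *ₚ q)) i)
      (trans (+-cong (coeff-· a q i) (get (∷-zero refl (*ₚ-zeroˡ p q (Vanishes-zero (Vanishes-tail Vp)))) i))
             (+-identityʳ _))
  top-coeff-* (a ∷ p) (suc k) q l Vp Vq with top-coeff-* p k q l (Vanishes-tail Vp) Vq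
  ... | (V , top) = vanishes high , trans (shifted (k ℕ.+ l)) (trans (+-cong (lowq (s≤s (ℕ.m≤n+m l k))) top) (+-identityˡ _))
    where
    shifted : ∀ i → coeff ((a ∷ p) *ₚ q) (suc i) ≈ a * coeff q (suc i) + coeff (p *ₚ q) i
    shifted i = trans (coeff-+ (a ·ₚ q) (0# ∷ (p *ₚ q)) (suc i)) (+-cong (coeff-· a q (suc i)) refl)
    lowq : ∀ {i} → suc l ≤ i → a * coeff q i ≈ 0#
    lowq l<i = trans (*-cong refl (vanish Vq _ l<i)) (zeroʳ a)
    high : ∀ i → suc (suc (k ℕ.+ l)) ≤ i → coeff ((a ∷ p) *ₚ q) i ≈ 0#
    high (suc i) (s≤s kl<i) = trans (shifted i)
      (trans (+-cong (lowq (s≤s (ℕ.≤-trans (ℕ.m≤n+m l k) (ℕ.≤-trans (ℕ.n≤1+n _) kl<i)))) (vanish V i kl<i)) (+-identityʳ 0#))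

  Deg-* : ∀ {p k q l} → Deg p k → Deg q l → Deg (p *ₚ q) (k ℕ.+ l)
  Deg-* {p} {k} {q} {l} (Vp , p≉0) (Vq , q≉0) with top-coeff-* p k q l Vp Vq
  ... | (V , top) = V , λ z → nonzero-* p≉0 q≉0 (trans (sym top) z)

  Monic-* : ∀ {p k q l} → Monic p k → Monic q l → Monic (p *ₚ q) (k ℕ.+ l)
  Monic-* {p} {k} {q} {l} (Vp , p1) (Vq , q1) with top-coeff-* p k q l Vp Vq
  ... | (V , top) = V , trans top (trans (*-cong p1 q1) (*-identityˡ 1#))

  Monic-+ˡ : ∀ {p k q} → Monic p k → Vanishes q k → Monic (q +ₚ p) k
  Monic-+ˡ {p} {k} {q} (Vp , p1) Vq = Vanishes-+ (Vanishes-mono Vq (ℕ.n≤1+n k)) Vp ,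
    trans (coeff-+ q p k) (trans (+-cong (vanish Vq k ℕ.≤-refl) p1) (+-identityˡ 1#))

  positive-degree : ∀ p → ¬ IsConstant p → ∃ λ a → Deg p (suc a)
  positive-degree p nonconst with degree? p
  ... | inj₁ p≋0              = ⊥-elim (nonconst λ i → get p≋0 (suc i))
  ... | inj₂ (zero , V , _)   = ⊥-elim (nonconst λ i → vanish V (suc i) (s≤s z≤n))
  ... | inj₂ (suc a , deg-p)  = a , deg-p

  Deg-scale : ∀ {l p k} → ¬ (l ≈ 0#) → Deg p k → Deg (const l *ₚ p) k
  Deg-scale {l} l≉0 deg-p = Deg-* {const l} {0} (Vanishes-const l , l≉0) deg-p

  Monic-X : Monic X 1
  Monic-X = vanishes (λ { zero () ; (suc zero) (s≤s ()) ; (suc (suc i)) _ → refl }) , refl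

  Monic-linear : ∀ b → Monic (X +ₚ const b) 1
  Monic-linear b = Monic-cong (+ₚ-comm (const b) X) (Monic-+ˡ Monic-X (Vanishes-const b))

  Monic-linear⁻ : ∀ b → Monic (X -ₚ const b) 1
  Monic-linear⁻ b = Monic-cong (+ₚ-comm (negₚ (const b)) X) (Monic-+ˡ Monic-X (Vanishes-· {p = const b} (Vanishes-const b)))

  Monic-∘ : ∀ {p k q l} → Monic p k → Monic q (suc l) → Monic (p ∘ₚ q) (k ℕ.* suc l)
  Monic-∘ {[]}    (_ , e) _ = ⊥-elim (1≉0 (sym e))
  Monic-∘ {a ∷ p} {zero} {q} (V , e) _ =
    Monic-cong (≋-sym (≋-trans (+ₚ-cong (≋-refl {const a})
                 (≋-trans (*ₚ-congʳ q (∘-zero p q (Vanishes-zero (Vanishes-tail V)))) (*ₚ-zeroʳ q))) (+ₚ-identityʳ _)))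
               (Vanishes-const a , e)
  Monic-∘ {a ∷ p} {suc k} {q} (V , e) Mq =
    Monic-+ˡ (Monic-* Mq (Monic-∘ {p} (Vanishes-tail V , e) Mq)) (Vanishes-mono (Vanishes-const a) (s≤s z≤n))

module Divisibility {c ℓ} (R : CommutativeRing c ℓ) (F : DecField R) where
  open import Data.Nat as ℕ using (zero; suc; s≤s; _<_; _∸_)
  import Data.Nat.Properties as ℕ
  open import Data.List using ([]; _∷_; length)
  open import Data.Product using (_,_; proj₁; proj₂; _×_; Σ-syntax)
  open import Data.Sum using (_⊎_; inj₁; inj₂)
  open import Data.Empty using (⊥-elim)
  open import Relation.Nullary using (yes; no)
  import Relation.Binary.PropositionalEquality as ≡
  open CommutativeRing R hiding (zero)
  open DecField F
  open Poly R
  open PolynomialRing R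
  open Composition R
  open Degrees R F
  open PolySolver using (solve; _:=_; _:+_; _:*_; _:-_)
  open import Algebra.Properties.Ring ring using (-1*x≈-x)

  Divides : Pol → Pol → Set (c Level.⊔ ℓ)
  Divides p A = ∃ λ C → A ≋ (p *ₚ C)

  Indecomposable : Pol → Set (c Level.⊔ ℓ)
  Indecomposable p = ∀ a b → p ≋ (a *ₚ b) → IsConstant a ⊎ IsConstant b

  monomial : Carrier → ℕ → Pol
  monomial a zero    = a ∷ []
  monomial a (suc e) = 0# ∷ monomial a e

  coeff-monomial-* : ∀ a e r j → coeff (monomial a e *ₚ r) (e ℕ.+ j) ≈ a * coeff r j
  coeff-monomial-* a zero r j =
    trans (coeff-+ (a ·ₚ r) (0# ∷ []) j) (trans (+-cong (coeff-· a r j) (get (∷-zero refl ≋-refl) j)) (+-identityʳ _))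
  coeff-monomial-* a (suc e) r j =
    trans (coeff-+ (0# ·ₚ r) (0# ∷ (monomial a e *ₚ r)) (suc (e ℕ.+ j)))
      (trans (+-cong (get (·ₚ-zero r refl) _) (coeff-monomial-* a e r j)) (+-identityˡ _))

  module Division {r d} (deg-r : Deg r d) where
    lc⁻¹ : Carrier
    lc⁻¹ = proj₁ (inverse (coeff r d) (proj₂ deg-r))

    -- If p vanishes from e + d + 1, subtracting (p_{e+d} / lc r)·xᵉ·r
    -- makes it vanish from e + d.
    leading-term : ∀ e p → Carrier
    leading-term e p = coeff p (e ℕ.+ d) * lc⁻¹

    reduce : ∀ e p → Pol
    reduce e p = p -ₚ (monomial (leading-term e p) e *ₚ r)

    reduce-vanishes : ∀ e p → Vanishes p (suc (e ℕ.+ d)) → Vanishes (reduce e p) (e ℕ.+ d)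
    reduce-vanishes e p V = vanishes λ i ed≤i →
      let e≤i = ℕ.≤-trans (ℕ.m≤m+n e d) ed≤i
          i≡ = ℕ.m+[n∸m]≡n e≤i
      in trans (coeff-≡ (reduce e p) (≡.sym i≡))
               (at (i ∸ e) (ℕ.+-cancelˡ-≤ e d (i ∸ e) (≡.subst (e ℕ.+ d ℕ.≤_) (≡.sym i≡) ed≤i)))
      where
      a = leading-term e p
      difference : ∀ j → coeff (reduce e p) (e ℕ.+ j) ≈ coeff p (e ℕ.+ j) + - 1# * (a * coeff r j)
      difference j = trans (coeff-+ p _ (e ℕ.+ j))
        (+-cong refl (trans (coeff-· (- 1#) (monomial a e *ₚ r) (e ℕ.+ j)) (*-cong refl (coeff-monomial-* a e r j))))
      cancels : coeff p (e ℕ.+ d) + - 1# * (a * coeff r d) ≈ 0#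
      cancels = trans (+-cong refl (trans (-1*x≈-x _) (-‿cong (begin
        (coeff p (e ℕ.+ d) * lc⁻¹) * coeff r d  ≈⟨ *-assoc _ _ _ ⟩
        coeff p (e ℕ.+ d) * (lc⁻¹ * coeff r d)  ≈⟨ *-cong refl (*-comm _ _) ⟩
        coeff p (e ℕ.+ d) * (coeff r d * lc⁻¹)  ≈⟨ *-cong refl (proj₂ (inverse (coeff r d) (proj₂ deg-r))) ⟩
        coeff p (e ℕ.+ d) * 1#                   ≈⟨ *-identityʳ _ ⟩
        coeff p (e ℕ.+ d)                        ∎))))
        (-‿inverseʳ _)
        where open import Relation.Binary.Reasoning.Setoid setoid
      at : ∀ j → d ℕ.≤ j → coeff (reduce e p) (e ℕ.+ j) ≈ 0#
      at j d≤j with ℕ.m≤n⇒m<n∨m≡n d≤j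
      ... | inj₂ ≡.refl = trans (difference d) cancels
      ... | inj₁ d<j = trans (difference j)
        (trans (+-cong (vanish V (e ℕ.+ j) (≡.subst (ℕ._≤ e ℕ.+ j) (ℕ.+-suc e d) (ℕ.+-monoʳ-≤ e d<j)))
                       (trans (*-cong refl (trans (*-cong refl (vanish (proj₁ deg-r) j d<j)) (zeroʳ a))) (zeroʳ _)))
               (+-identityʳ 0#))

    Quotient : Pol → Set (c Level.⊔ ℓ)
    Quotient p = Σ[ s ∈ Pol ] Σ[ t ∈ Pol ] (p ≋ ((s *ₚ r) +ₚ t)) × Vanishes t d

    divide-below : ∀ e p → Vanishes p (e ℕ.+ d) → Quotient p
    divide-below zero    p V = [] , p , ≋-refl , V
    divide-below (suc e) p V with divide-below e (reduce e p) (reduce-vanishes e p V)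
    ... | (s , t , E , Vt) = (s +ₚ m) , t , p≋ , Vt
      where
      m = monomial (leading-term e p) e
      p≋ : p ≋ (((s +ₚ m) *ₚ r) +ₚ t)
      p≋ = ≋-trans (solve 3 (λ p m r → p := (p :- m :* r) :+ m :* r) ≋-refl p m r)
             (≋-trans (+ₚ-cong E (≋-refl {m *ₚ r}))
               (solve 4 (λ s t m r → (s :* r :+ t) :+ m :* r := (s :+ m) :* r :+ t) ≋-refl s t m r))

    divide : ∀ p → Quotient p
    divide p = divide-below (length p) p (Vanishes-mono (Vanishes-length p) (ℕ.m≤m+n (length p) d))

  -- A polynomial of degree 0 is a unit, so it can be divided out.
  unit-divides : ∀ {p r Q C} → Deg r 0 → (r *ₚ Q) ≋ (p *ₚ C) → Divides p Q
  unit-divides {p} {r} {Q} {C} deg-r rQ with inverse (coeff r 0) (proj₂ deg-r)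
  ... | (r⁻¹ , rr⁻¹) = (const r⁻¹ *ₚ C) ,
    ≋-trans (≋-sym (*ₚ-identityˡ Q))
     (≋-trans (*ₚ-congˡ Q (≋-sym (≋-trans (≋-trans (*ₚ-comm (const r⁻¹) (const (coeff r 0))) (≋-sym (const-* (coeff r 0) r⁻¹))) (const-one rr⁻¹))))
      (≋-trans (*ₚ-assoc (const r⁻¹) (const (coeff r 0)) Q)
       (≋-trans (*ₚ-congʳ (const r⁻¹) (≋-trans (*ₚ-congˡ Q r≋) rQ))
        (solve 3 (λ a p C → a :* (p :* C) := p :* (a :* C)) ≋-refl (const r⁻¹) p C))))
    where
    r≋ : const (coeff r 0) ≋ r
    r≋ = ≋-sym (const-coeff₀ {r} λ i → vanish (proj₁ deg-r) (suc i) (s≤s ℕ.z≤n))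

  exact-division : ∀ {P t} s r → P ≋ ((s *ₚ r) +ₚ t) → t ≋ [] → P ≋ (s *ₚ r)
  exact-division s r E t≋0 = ≋-trans E (≋-trans (+ₚ-cong (≋-refl {s *ₚ r}) t≋0) (+ₚ-identityʳ _))

  module Euclid {p d} (deg-p : Deg p d) (indec : Indecomposable p) where
    open Division

    -- Induction on e: dividing p by r leaves a remainder t of smaller
    -- degree with p ∣ t·Q; if t = 0 then p = s·r, so r is a unit.
    cancel-small : ∀ fuel {e r Q} → e < fuel → Deg r e → e < d → Divides p (r *ₚ Q) → Divides p Q
    cancel-small (suc fuel) {e} {r} {Q} (s≤s e≤fuel) deg-r e<d (C , rQ) with divide deg-r p
    ... | (s , t , E , Vt) with degree? t
    ...   | inj₂ (e' , deg-t) =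
      let e'<e = Deg-< deg-t Vt in
      cancel-small fuel (ℕ.<-≤-trans e'<e e≤fuel) deg-t (ℕ.<-trans e'<e e<d) (_ , tQ)
      where
      tQ : (t *ₚ Q) ≋ (p *ₚ (Q -ₚ (s *ₚ C)))
      tQ = ≋-trans (*ₚ-congˡ Q (≋-trans (solve 3 (λ t s r → t := (s :* r :+ t) :- s :* r) ≋-refl t s r)
                                          (+ₚ-cong (≋-sym E) (≋-refl {negₚ (s *ₚ r)}))))
             (≋-trans (solve 4 (λ p s r Q → (p :- s :* r) :* Q := p :* Q :- s :* (r :* Q)) ≋-refl p s r Q)
               (≋-trans (+ₚ-cong (≋-refl {p *ₚ Q}) (negₚ-cong (*ₚ-congʳ s rQ)))
                 (solve 4 (λ p s C Q → p :* Q :- s :* (p :* C) := p :* (Q :- s :* C)) ≋-refl p s C Q)))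
    ...   | inj₁ t≋0 with indec s r (exact-division s r E t≋0)
    ...     | inj₁ s-const = ⊥-elim (proj₂ deg-p (begin
      coeff p d                          ≈⟨ get (exact-division s r E t≋0) d ⟩
      coeff (s *ₚ r) d                   ≈⟨ get (*ₚ-congˡ r (const-coeff₀ {s} s-const)) d ⟩
      coeff (const (coeff s 0) *ₚ r) d   ≈⟨ trans (get (const*ₚ _ r) d) (coeff-· _ r d) ⟩
      coeff s 0 * coeff r d              ≈⟨ *-cong refl (vanish (proj₁ deg-r) d e<d) ⟩
      coeff s 0 * 0#                     ≈⟨ zeroʳ _ ⟩
      0#                                 ∎))
      where
      open import Relation.Binary.Reasoning.Setoid setoid
    ...     | inj₂ r-const with e
    ...       | zero  = unit-divides {p} deg-r rQ
    ...       | suc e' = ⊥-elim (proj₂ deg-r (r-const e'))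

    prime : ∀ A B → Divides p (A *ₚ B) → Divides p A ⊎ Divides p B
    prime A B (C , AB) with divide deg-p A
    ... | (s , r , E , Vr) with degree? r
    ...   | inj₁ r≋0 = inj₁ (s , ≋-trans (exact-division s p E r≋0) (*ₚ-comm s p))
    ...   | inj₂ (e , deg-r) = inj₂ (cancel-small (suc e) (ℕ.n<1+n e) deg-r (Deg-< deg-r Vr) ((C -ₚ (s *ₚ B)) , rB))
      where
      rB : (r *ₚ B) ≋ (p *ₚ (C -ₚ (s *ₚ B)))
      rB = ≋-trans (*ₚ-congˡ B (≋-trans (solve 3 (λ r s p → r := (s :* p :+ r) :- s :* p) ≋-refl r s p)
                                          (+ₚ-cong (≋-sym E) (≋-refl {negₚ (s *ₚ p)}))))
             (≋-trans (solve 4 (λ A s p B → (A :- s :* p) :* B := A :* B :- s :* (p :* B)) ≋-refl A s p B)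
               (≋-trans (+ₚ-cong AB (≋-refl {negₚ (s *ₚ (p *ₚ B))}))
                 (solve 4 (λ p C s B → p :* C :- s :* (p :* B) := p :* (C :- s :* B)) ≋-refl p C s B)))

  *ₚ-cancelˡ : ∀ {p d A B} → Deg p d → (p *ₚ A) ≋ (p *ₚ B) → A ≋ B
  *ₚ-cancelˡ {p} {d} {A} {B} deg-p E with degree? (A -ₚ B)
  ... | inj₁ A-B≋0 = ≋-trans (solve 2 (λ A B → A := (A :- B) :+ B) ≋-refl A B) (+ₚ-cong A-B≋0 (≋-refl {B}))
  ... | inj₂ (k , deg) = ⊥-elim (Deg-nonzero (Deg-* deg-p deg) p[A-B]≋0)
    where
    p[A-B]≋0 : (p *ₚ (A -ₚ B)) ≋ []
    p[A-B]≋0 = ≋-trans (solve 3 (λ p A B → p :* (A :- B) := p :* A :- p :* B) ≋-refl p A B)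
                 (≋-trans (+ₚ-cong E (≋-refl {negₚ (p *ₚ B)})) (negₚ-inverseʳ (p *ₚ B)))

  Indecomposable-∘ : ∀ f {T T'} → (T ∘ₚ T') ≋ X → (T' ∘ₚ T) ≋ X → Indecomposable f → Indecomposable (f ∘ₚ T)
  Indecomposable-∘ f {T} {T'} TT' T'T indec a b fT≋ab with indec (a ∘ₚ T') (b ∘ₚ T') f≋
    where
    f≋ : f ≋ ((a ∘ₚ T') *ₚ (b ∘ₚ T'))
    f≋ = ≋-trans (≋-sym (∘-X f)) (≋-trans (∘-congʳ f (≋-sym TT')) (≋-trans (≋-sym (∘-assoc f T T'))
           (≋-trans (∘-congˡ T' fT≋ab) (*ₚ-∘ a b T'))))
  ... | inj₁ a-const = inj₁ (const-reflect a T' T T'T a-const)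
  ... | inj₂ b-const = inj₂ (const-reflect b T' T T'T b-const)

  constant-cofactor : ∀ {φ D N Q} → Deg φ D → (N *ₚ Q) ≋ φ → IsConstant Q → ∃ λ l → N ≋ (const l *ₚ φ)
  constant-cofactor {φ} {D} {N} {Q} deg-φ NQ≋φ Q-const with zero? (coeff Q 0)
  ... | yes q≈0 = ⊥-elim (Deg-nonzero deg-φ (≋-trans (≋-sym NQ≋φ)
                    (≋-trans (*ₚ-congʳ N (≋-trans (const-coeff₀ {Q} Q-const) (const-zero q≈0))) (*ₚ-zeroʳ N))))
  ... | no  q≉0 with inverse (coeff Q 0) q≉0
  ...   | (q⁻¹ , qq⁻¹≈1) = q⁻¹ ,
    ≋-trans (≋-sym (≋-trans (*ₚ-comm N 1ₚ) (*ₚ-identityˡ N)))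
     (≋-trans (*ₚ-congʳ N (≋-sym (≋-trans (≋-sym (const-* (coeff Q 0) q⁻¹)) (const-one qq⁻¹≈1))))
      (≋-trans (solve 3 (λ N q q' → N :* (q :* q') := q' :* (N :* q)) ≋-refl N (const (coeff Q 0)) (const q⁻¹))
       (*ₚ-congʳ (const q⁻¹) (≋-trans (*ₚ-congʳ N (≋-sym (const-coeff₀ {Q} Q-const))) NQ≋φ))))

  square-factor : ∀ {φ D N₁ N₂ a b} → Deg φ D → Indecomposable φ →
                  (N₁ *ₚ N₂) ≋ (φ *ₚ φ) → Deg N₁ (suc a) → Deg N₂ (suc b) →
                  ∃ λ l → N₁ ≋ (const l *ₚ φ)
  square-factor {φ} {D} {N₁} {N₂} {a} {b} deg-φ indec N₁N₂≋φφ deg-N₁ deg-N₂ =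
    by-primality (Euclid.prime deg-φ indec N₁ N₂ (φ , N₁N₂≋φφ))
    where
    cofactor₁ : ∀ Q → N₁ ≋ (φ *ₚ Q) → (Q *ₚ N₂) ≋ φ
    cofactor₁ Q N₁≋φQ = *ₚ-cancelˡ deg-φ
      (≋-trans (≋-sym (*ₚ-assoc φ Q N₂)) (≋-trans (*ₚ-congˡ N₂ (≋-sym N₁≋φQ)) N₁N₂≋φφ))
    cofactor₂ : ∀ Q → N₂ ≋ (φ *ₚ Q) → (N₁ *ₚ Q) ≋ φ
    cofactor₂ Q N₂≋φQ = *ₚ-cancelˡ deg-φ
      (≋-trans (solve 3 (λ φ N Q → φ :* (N :* Q) := N :* (φ :* Q)) ≋-refl φ N₁ Q)
        (≋-trans (*ₚ-congʳ N₁ (≋-sym N₂≋φQ)) N₁N₂≋φφ))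
    by-primality : Divides φ N₁ ⊎ Divides φ N₂ → ∃ λ l → N₁ ≋ (const l *ₚ φ)
    by-primality (inj₁ (Q , N₁≋φQ)) with indec Q N₂ (≋-sym (cofactor₁ Q N₁≋φQ))
    ... | inj₁ Q-const  = coeff Q 0 ,
      ≋-trans N₁≋φQ (≋-trans (*ₚ-congʳ φ (const-coeff₀ {Q} Q-const)) (*ₚ-comm φ (const (coeff Q 0))))
    ... | inj₂ N₂-const = ⊥-elim (proj₂ deg-N₂ (N₂-const b))
    by-primality (inj₂ (Q , N₂≋φQ)) with indec N₁ Q (≋-sym (cofactor₂ Q N₂≋φQ))
    ... | inj₁ N₁-const = ⊥-elim (proj₂ deg-N₁ (N₁-const a))
    ... | inj₂ Q-const  = constant-cofactor deg-φ (cofactor₂ Q N₂≋φQ) Q-const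

-- Doubling of natural numbers, by a recursion convenient for parities.

module Doubling where
  open import Data.Nat using (zero; suc; _+_; _*_)
  import Data.Nat.Properties as ℕ
  open import Relation.Binary.PropositionalEquality using (_≡_; refl; cong; trans; sym)

  twice : ℕ → ℕ
  twice zero    = zero
  twice (suc k) = suc (suc (twice k))

  twice≡+ : ∀ k → twice k ≡ k + k
  twice≡+ zero    = refl
  twice≡+ (suc k) = cong suc (trans (cong suc (twice≡+ k)) (sym (ℕ.+-suc k k)))

  twice≡2* : ∀ k → 2 * k ≡ twice k
  twice≡2* k = trans (cong (k +_) (ℕ.+-identityʳ k)) (sym (twice≡+ k))

open Doubling

-- p(-x) has coefficients (-1)ⁱ·pᵢ.  A polynomial P with P(-x) = P(x) has
-- vanishing odd coefficients (here 2 ≠ 0 is needed), hence P = N(x²)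
-- where N collects the even coefficients of P.

module Parity {c ℓ} (R : CommutativeRing c ℓ) (F : DecField R)
              (2≉0 : TwoNonzero R) where
  open import Data.Nat as ℕ using (zero; suc)
  import Data.Nat.Properties as ℕ
  open import Data.List using ([]; _∷_)
  open import Data.Product using (_,_)
  open import Data.Empty using (⊥-elim)
  open import Relation.Nullary using (yes; no)
  import Relation.Binary.PropositionalEquality as ≡
  open CommutativeRing R hiding (zero)
  open DecField F
  open Poly R
  open PolynomialRing R
  open Composition R
  open Degrees R F
  open PolySolver using (solve; _:=_; _:*_; :-_)
  open import Algebra.Properties.Ring ring using (-1*x≈-x; -‿distribˡ-*; -‿distribʳ-*; -‿involutive)

  data Parity : ℕ → Set where
    even : ∀ k → Parity (twice k)
    odd  : ∀ k → Parity (suc (twice k))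

  parity : ∀ i → Parity i
  parity zero    = even 0
  parity (suc i) with parity i
  ... | even k = odd k
  ... | odd k  = even (suc k)

  sign : ℕ → Carrier
  sign zero    = 1#
  sign (suc i) = - sign i

  sign² : ∀ i → sign i * sign i ≈ 1#
  sign² zero    = *-identityˡ 1#
  sign² (suc i) = trans (sym (-‿distribˡ-* _ _))
    (trans (-‿cong (sym (-‿distribʳ-* _ _))) (trans (-‿involutive _) (sign² i)))

  sign-even : ∀ k → sign (twice k) ≈ 1#
  sign-even zero    = refl
  sign-even (suc k) = trans (-‿involutive _) (sign-even k)

  -x : Pol
  -x = 0# ∷ (- 1#) ∷ []

  reflect : Pol → Pol
  reflect []      = []
  reflect (a ∷ p) = a ∷ negₚ (reflect p)

  ∘-x : ∀ p → (p ∘ₚ -x) ≋ reflect p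
  ∘-x []      = ≋-refl
  ∘-x (a ∷ p) = ≋-trans (+ₚ-cong (≋-refl {const a}) (≋-trans (*ₚ-congʳ -x (∘-x p)) -x*ₚ))
                        (∷-cong (+-identityʳ a) ≋-refl)
    where
    -x*ₚ : (-x *ₚ reflect p) ≋ (0# ∷ negₚ (reflect p))
    -x*ₚ = +ₚ-cong (·ₚ-zero (reflect p) refl) (∷-cong refl (const*ₚ (- 1#) (reflect p)))

  coeff-reflect : ∀ p i → coeff (reflect p) i ≈ sign i * coeff p i
  coeff-reflect []      i       = sym (zeroʳ _)
  coeff-reflect (a ∷ p) zero    = sym (*-identityˡ a)
  coeff-reflect (a ∷ p) (suc i) = trans (coeff-· (- 1#) (reflect p) i)
    (trans (-1*x≈-x _) (trans (-‿cong (coeff-reflect p i)) (-‿distribˡ-* _ _)))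

  Deg-reflect : ∀ {p k} → Deg p k → Deg (p ∘ₚ -x) k
  Deg-reflect {p} {k} (V , p≉0) = Deg-cong (≋-sym (∘-x p)) (V' , reflect≉0)
    where
    V' = vanishes λ i k<i → trans (coeff-reflect p i) (trans (*-cong refl (vanish V i k<i)) (zeroʳ _))
    reflect≉0 : ¬ (coeff (reflect p) k ≈ 0#)
    reflect≉0 z = p≉0 (begin
      coeff p k                          ≈⟨ *-identityˡ _ ⟨
      1# * coeff p k                     ≈⟨ *-cong (sign² k) refl ⟨
      (sign k * sign k) * coeff p k      ≈⟨ *-assoc _ _ _ ⟩
      sign k * (sign k * coeff p k)      ≈⟨ *-cong refl (trans (sym (coeff-reflect p k)) z) ⟩
      sign k * 0#                        ≈⟨ zeroʳ _ ⟩
      0#                                 ∎)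
      where open import Relation.Binary.Reasoning.Setoid setoid

  -x∘-x : (-x ∘ₚ -x) ≋ X
  -x∘-x = ≋-trans (∘-x -x) (mk λ
    { zero          → refl
    ; (suc zero)    → trans (coeff-· (- 1#) (reflect (- 1# ∷ [])) 0) (trans (-1*x≈-x _) (-‿involutive _))
    ; (suc (suc i)) → trans (coeff-· (- 1#) (reflect (- 1# ∷ [])) (suc i)) (zeroʳ _) })

  reflect-involutive : ∀ p → ((p ∘ₚ -x) ∘ₚ -x) ≋ p
  reflect-involutive p = ≋-trans (∘-assoc p -x -x) (≋-trans (∘-congʳ p -x∘-x) (∘-X p))

  x²∘-x : (x² ∘ₚ -x) ≋ x²
  x²∘-x = ≋-trans (*ₚ-∘ X X -x) (≋-trans (*ₚ-cong (X-∘ -x) (X-∘ -x))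
            (≋-trans (*ₚ-cong -x≋ -x≋) (solve 1 (λ x → (:- x) :* (:- x) := x :* x) ≋-refl X)))
    where
    -x≋ : -x ≋ negₚ X
    -x≋ = mk λ { zero → sym (zeroʳ _) ; (suc zero) → sym (*-identityʳ _) ; (suc (suc i)) → refl }

  spread : Pol → Pol
  spread []      = []
  spread (a ∷ q) = a ∷ 0# ∷ spread q

  ∘x² : ∀ q → (q ∘ₚ x²) ≋ spread q
  ∘x² []      = ≋-refl
  ∘x² (a ∷ q) = ≋-trans (+ₚ-cong (≋-refl {const a}) (≋-trans (*ₚ-congʳ x² (∘x² q))
      (≋-trans (*ₚ-assoc X X (spread q)) (≋-trans (*ₚ-congʳ X (X*ₚ (spread q))) (X*ₚ (0# ∷ spread q))))))
    (∷-cong (+-identityʳ a) ≋-refl)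

  coeff-spread-even : ∀ q k → coeff (spread q) (twice k) ≈ coeff q k
  coeff-spread-even []      k       = refl
  coeff-spread-even (a ∷ q) zero    = refl
  coeff-spread-even (a ∷ q) (suc k) = coeff-spread-even q k

  coeff-spread-odd : ∀ q k → coeff (spread q) (suc (twice k)) ≈ 0#
  coeff-spread-odd []      k       = refl
  coeff-spread-odd (a ∷ q) zero    = refl
  coeff-spread-odd (a ∷ q) (suc k) = coeff-spread-odd q k

  ∘x²-injective : ∀ {a b} → (a ∘ₚ x²) ≋ (b ∘ₚ x²) → a ≋ b
  ∘x²-injective {a} {b} E = mk λ k →
    trans (sym (coeff-spread-even a k)) (trans (get (≋-trans (≋-sym (∘x² a)) (≋-trans E (∘x² b))) (twice k)) (coeff-spread-even b k))

  evens : Pol → Pol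
  evens []          = []
  evens (a ∷ [])    = a ∷ []
  evens (a ∷ b ∷ p) = a ∷ evens p

  coeff-evens : ∀ p k → coeff (evens p) k ≈ coeff p (twice k)
  coeff-evens []          k       = refl
  coeff-evens (a ∷ [])    zero    = refl
  coeff-evens (a ∷ [])    (suc k) = refl
  coeff-evens (a ∷ b ∷ p) zero    = refl
  coeff-evens (a ∷ b ∷ p) (suc k) = coeff-evens p k

  Deg-evens : ∀ {P a} → Deg P (a ℕ.+ a) → Deg (evens P) a
  Deg-evens {P} {a} (V , P≉0) =
    vanishes (λ k a<k → trans (coeff-evens P k) (vanish V (twice k) (twice-< a<k))) ,
    λ z → P≉0 (trans (coeff-≡ P (≡.sym (twice≡+ a))) (trans (sym (coeff-evens P a)) z))
    where
    twice-< : ∀ {a k} → suc a ℕ.≤ k → suc (a ℕ.+ a) ℕ.≤ twice k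
    twice-< {a} {k} a<k = ≡.subst (suc (a ℕ.+ a) ℕ.≤_) (≡.sym (twice≡+ k)) (ℕ.+-mono-≤ a<k (ℕ.≤-trans (ℕ.n≤1+n a) a<k))

  self-negative : ∀ {x} → x ≈ - x → x ≈ 0#
  self-negative {x} e with zero? x
  ... | yes x≈0 = x≈0
  ... | no  x≉0 = ⊥-elim (nonzero-* 2≉0 x≉0 (trans (distribʳ x 1# 1#)
                    (trans (+-cong (*-identityˡ x) (trans (*-identityˡ x) e)) (-‿inverseʳ x))))

  even-in-x² : ∀ P → (P ∘ₚ -x) ≋ P → P ≋ (evens P ∘ₚ x²)
  even-in-x² P P-even = ≋-trans (mk λ i → at i (parity i)) (≋-sym (∘x² (evens P)))
    where
    at : ∀ i → Parity i → coeff P i ≈ coeff (spread (evens P)) i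
    at _ (even k) = sym (trans (coeff-spread-even (evens P) k) (coeff-evens P k))
    at _ (odd k)  = trans (self-negative (begin
        coeff P (suc (twice k))                         ≈⟨ get P-even _ ⟨
        coeff (P ∘ₚ -x) (suc (twice k))                 ≈⟨ get (∘-x P) _ ⟩
        coeff (reflect P) (suc (twice k))               ≈⟨ coeff-reflect P _ ⟩
        - sign (twice k) * coeff P (suc (twice k))      ≈⟨ *-cong (-‿cong (sign-even k)) refl ⟩
        - 1# * coeff P (suc (twice k))                  ≈⟨ -1*x≈-x _ ⟩
        - coeff P (suc (twice k))                       ∎))
      (sym (coeff-spread-odd (evens P) k))
      where open import Relation.Binary.Reasoning.Setoid setoid

-- Proof: the norm N(A), defined by N(A)(x²) = A(x)·A(-x), satisfies
-- N(A)·N(B) = φ², so by unique factorisation N(A) = l·φ.  Comparing top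
-- coefficients (deg A = deg φ is even) gives l = lc(A)², and comparing
-- constant coefficients gives A(0)² = l·φ(0); hence φ(0) = (A(0)/lc(A))².

module SquareCriterion {c ℓ} (R : CommutativeRing c ℓ) (F : DecField R)
              (2≉0 : TwoNonzero R) where
  open import Data.Nat as ℕ using (zero; suc)
  open import Data.Product using (_,_; proj₁; proj₂)
  import Relation.Binary.PropositionalEquality as ≡
  open CommutativeRing R hiding (zero)
  open DecField F
  open Poly R
  open PolynomialRing R
  open Composition R
  open Degrees R F
  open Divisibility R F
  open Parity R F 2≉0
  open PolySolver using (solve; _:=_; _:*_)

  norm : Pol → Pol
  norm A = evens (A *ₚ (A ∘ₚ -x))

  norm-spec : ∀ A → (A *ₚ (A ∘ₚ -x)) ≋ (norm A ∘ₚ x²)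
  norm-spec A = even-in-x² (A *ₚ (A ∘ₚ -x))
    (≋-trans (*ₚ-∘ A (A ∘ₚ -x) -x) (≋-trans (*ₚ-congʳ (A ∘ₚ -x) (reflect-involutive A)) (*ₚ-comm (A ∘ₚ -x) A)))

  norm-* : ∀ {φ A B} → (φ ∘ₚ x²) ≋ (A *ₚ B) → (norm A *ₚ norm B) ≋ (φ *ₚ φ)
  norm-* {φ} {A} {B} φx²≋AB = ∘x²-injective (begin
    (norm A *ₚ norm B) ∘ₚ x²                          ≈⟨ *ₚ-∘ (norm A) (norm B) x² ⟩
    (norm A ∘ₚ x²) *ₚ (norm B ∘ₚ x²)                  ≈⟨ *ₚ-cong (norm-spec A) (norm-spec B) ⟨
    (A *ₚ (A ∘ₚ -x)) *ₚ (B *ₚ (B ∘ₚ -x))              ≈⟨ solve 4 (λ a a' b b' → (a :* a') :* (b :* b') := (a :* b) :* (a' :* b'))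
                                                           ≋-refl A (A ∘ₚ -x) B (B ∘ₚ -x) ⟩
    (A *ₚ B) *ₚ ((A ∘ₚ -x) *ₚ (B ∘ₚ -x))              ≈⟨ *ₚ-congʳ (A *ₚ B) (*ₚ-∘ A B -x) ⟨
    (A *ₚ B) *ₚ ((A *ₚ B) ∘ₚ -x)                      ≈⟨ *ₚ-cong (≋-sym φx²≋AB) (∘-congˡ -x (≋-sym φx²≋AB)) ⟩
    (φ ∘ₚ x²) *ₚ ((φ ∘ₚ x²) ∘ₚ -x)                    ≈⟨ *ₚ-congʳ (φ ∘ₚ x²) (≋-trans (∘-assoc φ x² -x) (∘-congʳ φ x²∘-x)) ⟩
    (φ ∘ₚ x²) *ₚ (φ ∘ₚ x²)                            ≈⟨ *ₚ-∘ φ φ x² ⟨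
    (φ *ₚ φ) ∘ₚ x²                                    ∎)
    where open import Relation.Binary.Reasoning.Setoid (CommutativeRing.setoid polyRing)

  Deg-norm : ∀ {A a} → Deg A a → Deg (norm A) a
  Deg-norm {A} deg-A = Deg-evens (Deg-* deg-A (Deg-reflect deg-A))

  norm-top : ∀ {A a} → Deg A a → coeff (norm A) a ≈ coeff A a * (sign a * coeff A a)
  norm-top {A} {a} deg-A = begin
    coeff (norm A) a                        ≈⟨ coeff-evens (A *ₚ (A ∘ₚ -x)) a ⟩
    coeff (A *ₚ (A ∘ₚ -x)) (twice a)        ≈⟨ coeff-≡ (A *ₚ (A ∘ₚ -x)) (twice≡+ a) ⟩
    coeff (A *ₚ (A ∘ₚ -x)) (a ℕ.+ a)        ≈⟨ proj₂ (top-coeff-* A a (A ∘ₚ -x) a (proj₁ deg-A) (proj₁ (Deg-reflect deg-A))) ⟩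
    coeff A a * coeff (A ∘ₚ -x) a           ≈⟨ *-cong refl (trans (get (∘-x A) a) (coeff-reflect A a)) ⟩
    coeff A a * (sign a * coeff A a)        ∎
    where open import Relation.Binary.Reasoning.Setoid setoid

  norm-bottom : ∀ A → coeff (norm A) 0 ≈ coeff A 0 * coeff A 0
  norm-bottom A = begin
    coeff (norm A) 0                        ≈⟨ coeff-evens (A *ₚ (A ∘ₚ -x)) 0 ⟩
    coeff (A *ₚ (A ∘ₚ -x)) 0                ≈⟨ coeff₀-* A (A ∘ₚ -x) ⟩
    coeff A 0 * coeff (A ∘ₚ -x) 0           ≈⟨ *-cong refl (trans (get (∘-x A) 0) (trans (coeff-reflect A 0) (*-identityˡ _))) ⟩
    coeff A 0 * coeff A 0                   ∎
    where open import Relation.Binary.Reasoning.Setoid setoid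

  square-of-quotient : ∀ {x u z} → ¬ (u ≈ 0#) → x * x ≈ (u * u) * z → ∃ λ y → y * y ≈ z
  square-of-quotient {x} {u} {z} u≉0 x²≈u²z with inverse u u≉0
  ... | (u⁻¹ , uu⁻¹≈1) = x * u⁻¹ , (begin
    (x * u⁻¹) * (x * u⁻¹)          ≈⟨ S.solve 2 (λ x v → (x S.:* v) S.:* (x S.:* v) S.:= (x S.:* x) S.:* (v S.:* v)) refl x u⁻¹ ⟩
    (x * x) * (u⁻¹ * u⁻¹)          ≈⟨ *-cong x²≈u²z refl ⟩
    ((u * u) * z) * (u⁻¹ * u⁻¹)    ≈⟨ S.solve 3 (λ u z v → ((u S.:* u) S.:* z) S.:* (v S.:* v) S.:= z S.:* ((u S.:* v) S.:* (u S.:* v))) refl u z u⁻¹ ⟩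
    z * ((u * u⁻¹) * (u * u⁻¹))    ≈⟨ *-cong refl (trans (*-cong uu⁻¹≈1 uu⁻¹≈1) (*-identityˡ 1#)) ⟩
    z * 1#                         ≈⟨ *-identityʳ z ⟩
    z                              ∎)
    where
    module S = RingSolver R
    open import Relation.Binary.Reasoning.Setoid setoid

  square-criterion : ∀ {φ k} → Monic φ (twice k) → Indecomposable φ →
                     ∀ A B → (φ ∘ₚ x²) ≋ (A *ₚ B) → ¬ IsConstant A → ¬ IsConstant B →
                     ∃ λ y → y * y ≈ coeff φ 0
  square-criterion {φ} {k} monic-φ indec A B φx²≋AB A-nonconst B-nonconst =
    square-of-quotient (proj₂ deg-A) (begin
      coeff A 0 * coeff A 0            ≈⟨ norm-bottom A ⟨
      coeff (norm A) 0                 ≈⟨ coeff-scaled 0 ⟩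
      l * coeff φ 0                    ≈⟨ *-cong l≈lc² refl ⟩
      (lc * lc) * coeff φ 0            ∎)
    where
    open import Relation.Binary.Reasoning.Setoid setoid
    a = suc (proj₁ (positive-degree A A-nonconst))
    deg-A : Deg A a
    deg-A = proj₂ (positive-degree A A-nonconst)
    lc = coeff A a
    deg-φ : Deg φ (twice k)
    deg-φ = Monic⇒Deg monic-φ
    associate : ∃ λ l → norm A ≋ (const l *ₚ φ)
    associate = square-factor deg-φ indec (norm-* {φ} {A} {B} φx²≋AB) (Deg-norm deg-A) (Deg-norm (proj₂ (positive-degree B B-nonconst)))
    l = proj₁ associate
    coeff-scaled : ∀ i → coeff (norm A) i ≈ l * coeff φ i
    coeff-scaled i = trans (get (proj₂ associate) i) (trans (get (const*ₚ l φ) i) (coeff-· l φ i))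
    l≉0 : ¬ (l ≈ 0#)
    l≉0 l≈0 = proj₂ (Deg-norm deg-A) (trans (coeff-scaled a) (trans (*-cong l≈0 refl) (zeroˡ _)))
    -- deg A = deg N(A) = deg φ is even
    a≡2k : a ≡.≡ twice k
    a≡2k = Deg-unique (Deg-norm deg-A) (Deg-cong (≋-sym (proj₂ associate)) (Deg-scale l≉0 deg-φ))
    l≈lc² : l ≈ lc * lc
    l≈lc² = begin
      l                                ≈⟨ *-identityʳ l ⟨
      l * 1#                           ≈⟨ *-cong refl (proj₂ monic-φ) ⟨
      l * coeff φ (twice k)            ≈⟨ coeff-scaled (twice k) ⟨
      coeff (norm A) (twice k)         ≈⟨ coeff-≡ (norm A) (≡.sym a≡2k) ⟩
      coeff (norm A) a                 ≈⟨ norm-top deg-A ⟩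
      lc * (sign a * lc)               ≈⟨ *-cong refl (trans (*-cong (trans (reflexive (≡.cong sign a≡2k)) (sign-even k)) refl) (*-identityˡ lc)) ⟩
      lc * lc                          ∎

-- Number fields are fields with decidable equality (an element is zero iff
-- all its coordinates in the ℚ-basis are) in which 2 ≠ 0.

module NumberFieldFacts {c ℓ} (K : NumberField c ℓ) where
  open import Data.Nat using (zero; suc)
  open import Data.Fin using (Fin; zero; suc)
  open import Data.Fin.Properties using (all?)
  open import Data.Product using (_,_)
  open import Relation.Nullary using (yes; no)
  import Relation.Binary.PropositionalEquality as ≡
  import Data.Rational as ℚ
  open NumberField K renaming (ring to K-ring)
  open CommutativeRing K-ring hiding (zero)
  open import Algebra.Properties.Ring ring using (x+x≈x⇒x≈0)

  ι-0 : ι ℚ.0ℚ ≈ 0#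
  ι-0 = x+x≈x⇒x≈0 _ (sym (ι-+ ℚ.0ℚ ℚ.0ℚ))

  ΣFin-zero : ∀ d (f : Fin d → Carrier) → (∀ i → f i ≈ 0#) → ΣFin K-ring d f ≈ 0#
  ΣFin-zero zero    f f≈0 = refl
  ΣFin-zero (suc d) f f≈0 = trans (+-cong (f≈0 zero) (ΣFin-zero d (λ i → f (suc i)) (λ i → f≈0 (suc i)))) (+-identityʳ 0#)

  decField : DecField K-ring
  decField = record { 1≉0 = 1≉0 ; inverse = inverse ; zero? = zero? }
    where
    zero? : ∀ x → Dec (x ≈ 0#)
    zero? x with spans x
    ... | (a , x≈Σ) with all? (λ i → a i ℚ.≟ ℚ.0ℚ)
    ...   | yes a≡0 = yes (trans x≈Σ (ΣFin-zero dim _ λ i →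
                        trans (*-cong (trans (reflexive (≡.cong ι (a≡0 i))) ι-0) refl) (zeroˡ _)))
    ...   | no  a≢0 = no λ x≈0 → a≢0 (indep a (trans (sym x≈Σ) x≈0))

  -- 2 ≠ 0, since 2 · ι(½) = ι(1) = 1.
  2≉0 : TwoNonzero K-ring
  2≉0 2≈0 = 1≉0 (begin
    1#                              ≈⟨ ι-1 ⟨
    ι ℚ.1ℚ                          ≡⟨⟩
    ι ((ℚ.1ℚ ℚ.+ ℚ.1ℚ) ℚ.* ℚ.½)     ≈⟨ ι-* _ ℚ.½ ⟩
    ι (ℚ.1ℚ ℚ.+ ℚ.1ℚ) * ι ℚ.½       ≈⟨ *-cong (trans (ι-+ ℚ.1ℚ ℚ.1ℚ) (+-cong ι-1 ι-1)) refl ⟩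
    (1# + 1#) * ι ℚ.½               ≈⟨ *-cong 2≈0 refl ⟩
    0# * ι ℚ.½                      ≈⟨ zeroˡ _ ⟩
    0#                              ∎)
    where open import Relation.Binary.Reasoning.Setoid setoid

-- Writing o = m + γ, the translate g(x + γ) = x² + o is centred, so
-- gⁿ⁺¹(x + γ) = gⁿ(x² + o) = φₙ(x²) for φₙ(x) = gⁿ(x + o); and
-- φₙ(0) = gⁿ(o) = tₙ₊₁(m).

module Dynamics {c ℓ} (R : CommutativeRing c ℓ) (F : DecField R) (γ m : CommutativeRing.Carrier R) where
  open import Data.Nat as ℕ using (zero; suc; _^_)
  import Data.Nat.Properties as ℕ
  open import Data.Product using (_,_)
  import Relation.Binary.PropositionalEquality as ≡
  open CommutativeRing R hiding (zero)
  open Poly R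
  open Dyn R
  open PolynomialRing R
  open Composition R
  open Degrees R F
  open Divisibility R F

  o : Carrier
  o = m + γ

  G : Pol
  G = g γ m

  centred : ℕ → Pol
  centred n = iter G n ∘ₚ (X +ₚ const o)

  iter-suc : ∀ k → iter G (suc k) ≋ (iter G k ∘ₚ G)
  iter-suc zero    = ≋-trans (∘-X G) (≋-sym (X-∘ G))
  iter-suc (suc k) = ≋-trans (∘-congʳ G (iter-suc k)) (≋-sym (∘-assoc G (iter G k) G))

  g-translate : (G ∘ₚ (X +ₚ const γ)) ≋ (x² +ₚ const o)
  g-translate = ≋-trans (+ₚ-∘ ((X -ₚ const γ) *ₚ (X -ₚ const γ)) (const o) (X +ₚ const γ))
    (+ₚ-cong (≋-trans (*ₚ-∘ (X -ₚ const γ) (X -ₚ const γ) (X +ₚ const γ))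
                      (*ₚ-cong (untranslate-translate γ) (untranslate-translate γ)))
             (const-∘ o (X +ₚ const γ)))

  iter-translate : ∀ n → (iter G (suc n) ∘ₚ (X +ₚ const γ)) ≋ (centred n ∘ₚ x²)
  iter-translate n = begin
    iter G (suc n) ∘ₚ (X +ₚ const γ)            ≈⟨ ∘-congˡ (X +ₚ const γ) (iter-suc n) ⟩
    (iter G n ∘ₚ G) ∘ₚ (X +ₚ const γ)           ≈⟨ ∘-assoc (iter G n) G (X +ₚ const γ) ⟩
    iter G n ∘ₚ (G ∘ₚ (X +ₚ const γ))           ≈⟨ ∘-congʳ (iter G n) g-translate ⟩
    iter G n ∘ₚ (x² +ₚ const o)                 ≈⟨ ∘-congʳ (iter G n) (translate-∘ o x²) ⟨
    iter G n ∘ₚ ((X +ₚ const o) ∘ₚ x²)          ≈⟨ ∘-assoc (iter G n) (X +ₚ const o) x² ⟨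
    centred n ∘ₚ x²                             ∎
    where open import Relation.Binary.Reasoning.Setoid (CommutativeRing.setoid polyRing)

  Monic-g : Monic G 2
  Monic-g = Monic-cong (+ₚ-comm (const o) square)
    (Monic-+ˡ {square} {2} {const o} (Monic-* {X -ₚ const γ} {1} {X -ₚ const γ} {1} (Monic-linear⁻ γ) (Monic-linear⁻ γ))
              (Vanishes-mono (Vanishes-const o) (ℕ.s≤s ℕ.z≤n)))
    where square = (X -ₚ const γ) *ₚ (X -ₚ const γ)

  Monic-iter : ∀ k → Monic (iter G k) (2 ^ k)
  Monic-iter zero    = Monic-X
  Monic-iter (suc k) = ≡.subst (Monic (iter G (suc k))) (ℕ.*-comm (2 ^ k) 2)
                         (Monic-cong (≋-sym (iter-suc k)) (Monic-∘ {iter G k} {2 ^ k} {G} {1} (Monic-iter k) Monic-g))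

  Monic-centred : ∀ k → Monic (centred k) (2 ^ k)
  Monic-centred k = ≡.subst (Monic (centred k)) (ℕ.*-identityʳ (2 ^ k)) (Monic-∘ {iter G k} {2 ^ k} {X +ₚ const o} {0} (Monic-iter k) (Monic-linear o))

  Monic-centred-even : ∀ k → Monic (centred (suc k)) (twice (2 ^ k))
  Monic-centred-even k = ≡.subst (Monic (centred (suc k))) (twice≡2* (2 ^ k)) (Monic-centred (suc k))

  centred-factorisation : ∀ n A B → iter G (suc n) ≈ₚ (A *ₚ B) →
                          (centred n ∘ₚ x²) ≋ ((A ∘ₚ (X +ₚ const γ)) *ₚ (B ∘ₚ (X +ₚ const γ)))
  centred-factorisation n A B E =
    ≋-trans (≋-sym (iter-translate n)) (≋-trans (∘-congˡ {iter G (suc n)} {A *ₚ B} (X +ₚ const γ) (mk E)) (*ₚ-∘ A B (X +ₚ const γ)))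

  Indecomposable-centred : ∀ n → Irreducible (iter G n) → Indecomposable (centred n)
  Indecomposable-centred n irreducible = Indecomposable-∘ (iter G n) {X +ₚ const o} {X -ₚ const o} (translate-untranslate o) (untranslate-translate o)
    λ a b E → Data.Product.proj₂ irreducible a b (get E)

  iter-value : ∀ k → eval (iter G k) o ≈ eval (t γ (suc k)) m
  iter-value zero    = trans (eval-X o) (sym (trans (eval-+ X (const γ) m) (+-cong (eval-X m) (eval-const γ m))))
  iter-value (suc k) = begin
    eval (G ∘ₚ iter G k) o                          ≈⟨ eval-∘ G (iter G k) o ⟩
    eval G (eval (iter G k) o)                       ≈⟨ eval-congʳ G (iter-value k) ⟩
    eval G v                                         ≈⟨ eval-+ ((X -ₚ const γ) *ₚ (X -ₚ const γ)) (const o) v ⟩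
    eval ((X -ₚ const γ) *ₚ (X -ₚ const γ)) v + eval (const o) v
                                                     ≈⟨ +-cong (trans (eval-* (X -ₚ const γ) (X -ₚ const γ) v) (*-cong (shifted X (eval-X v)) (shifted X (eval-X v))))
                                                                (eval-const o v) ⟩
    (v - γ) * (v - γ) + (m + γ)                      ≈⟨ +-assoc _ m γ ⟨
    ((v - γ) * (v - γ) + m) + γ                      ≈⟨ t-step ⟨
    eval (t γ (suc (suc k))) m                       ∎
    where
    open import Relation.Binary.Reasoning.Setoid setoid
    v = eval (t γ (suc k)) m
    shifted : ∀ p {z w} → eval p z ≈ w → eval (p -ₚ const γ) z ≈ w - γ
    shifted p {z} e = trans (eval--ₚ p (const γ) z) (+-cong e (-‿cong (eval-const γ z)))
    T = t γ (suc k) -ₚ const γ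
    t-step : eval (t γ (suc (suc k))) m ≈ ((v - γ) * (v - γ) + m) + γ
    t-step = trans (eval-+ ((T *ₚ T) +ₚ X) (const γ) m)
      (+-cong (trans (eval-+ (T *ₚ T) X m) (+-cong (trans (eval-* T T m) (*-cong (shifted (t γ (suc k)) refl) (shifted (t γ (suc k)) refl))) (eval-X m)))
              (eval-const γ m))

  centred-constant-term : ∀ n → coeff (centred n) 0 ≈ eval (t γ (suc n)) m
  centred-constant-term n =
    trans (coeff₀-∘ (iter G n) (X +ₚ const o)) (trans (eval-congʳ (iter G n) (+-identityˡ o)) (iter-value n))

theorem4p1 : ∀ {c ℓ} (K : NumberField c ℓ)
    (γ m : CommutativeRing.Carrier (NumberField.ring K)) (n : ℕ) → 1 ≤ n →
    Poly.Irreducible (NumberField.ring K) (Poly.iter (NumberField.ring K) (Dyn.g (NumberField.ring K) γ m) n) →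
    Poly.Reducible (NumberField.ring K) (Poly.iter (NumberField.ring K) (Dyn.g (NumberField.ring K) γ m) (suc n)) →
    ∃ λ y → CommutativeRing._≈_ (NumberField.ring K)
      (CommutativeRing._*_ (NumberField.ring K) y y)
      (Poly.eval (NumberField.ring K) (Dyn.t (NumberField.ring K) γ (suc n)) m)
theorem4p1 K γ m zero    ()
theorem4p1 K γ m (suc k) _ irreducible (A , B , factorisation , A-nonconst , B-nonconst) =
  map₂ (λ y²≈φ₀ → trans y²≈φ₀ (centred-constant-term (suc k)))
    (square-criterion (Monic-centred-even k) (Indecomposable-centred (suc k) irreducible)
                      (A ∘ₚ translation) (B ∘ₚ translation) (centred-factorisation (suc k) A B factorisation)
                      (translate-nonconstant γ A A-nonconst) (translate-nonconstant γ B B-nonconst))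
  where
  open NumberFieldFacts K using (decField; 2≉0)
  open CommutativeRing (NumberField.ring K) using (trans)
  open Composition (NumberField.ring K) using (translate-nonconstant)
  open Dynamics (NumberField.ring K) decField γ m
  open SquareCriterion (NumberField.ring K) decField 2≉0 using (square-criterion)
  open Poly (NumberField.ring K) using (Pol; X; const; _+ₚ_; _∘ₚ_)
  translation : Pol
  translation = X +ₚ const γ
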